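{- Let $p \geq 5$ be a prime with $p \equiv -1 \pmod 6$. Then $M_n \equiv 0 \pmod p$ whenever $n$ has one of the following forms: (i) $n = (pi+1)p^{2k} - 2$ with integers $i \geq 0$, $k \geq 1$; (ii) $n = (pi + p - 2)p^{2k+1} - 2$ with integers $i \geq 0$, $k \geq 0$; (iii) $n = (pi+2)p^{2k+1} - 1$ with integers $i \geq 0$, $k \geq 0$; (iv) $n = (pi + p - 1)p^{2k} - 1$ with integers $i \geq 0$, $k \geq 1$.
   Context: The Motzkin numbers are $M_n = \sum_{k \geq 0} \binom{n}{2k} C_k$, where $C_k = \frac{1}{k+1}\binom{2k}{k}$ are the Catalan numbers. -}

module Defs where

open import Data.Nat using (ℕ; zero; suc; _+_; _*_; _/_)
open import Data.Nat.Combinatorics using (_C_)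

-- Catalan numbers C_k = (1/(k+1)) * binom(2k, k)  (exact division)
catalan : ℕ → ℕ
catalan k = ((2 * k) C k) / suc k

sumTo : ℕ → (ℕ → ℕ) → ℕ
sumTo zero    f = f 0
sumTo (suc m) f = sumTo m f + f (suc m)

-- Motzkin numbers M_n = Σ_{k ≥ 0} binom(n, 2k) C_k ; terms with 2k > n vanish,
-- so summing k from 0 to n covers all nonzero terms.
motzkin : ℕ → ℕ
motzkin n = sumTo n (λ k → (n C (2 * k)) * catalan k)

{-# OPTIONS --safe #-}
-- Let T n j be the coefficient of xʲ in (1 + x + x²)ⁿ. Expanding (x + (1 + x²))ⁿ gives
-- Mₙ = T n n − T n (n + 2). Since (1 + x + x²)ᵖ ≡ 1 + xᵖ + x²ᵖ (mod p), a Lucas-type rule expresses,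
-- for n = m·p + r, the numbers T n n, T n (n + 1), T n (n + 2) modulo p through A = T m m,
-- B = T m (m + 1) and entries of row r. Each of the four families consists of the n whose base-p
-- expansion is a prefix followed by a run of digits p − 1 and a last digit p − 1 or p − 2; a digit
-- p − 1 maps (A, B) to (−A, B + A), so only the parity of the run matters. The entries of the rows
-- p − 1, p − 2, p − 3 that occur come from (1 + x + x²)ᵖ⁻ᵏ ≡ (1 + xᵖ + x²ᵖ) · (1 + x + x²)⁻ᵏ, whose
-- coefficients for k = 1, 2, 3 are periodic, linear and quadratic along residue classes mod 3;
-- for p ≡ 5 (mod 6) the resulting combinations are multiples of p.
module Submission where

open import Data.Nat.Base as ℕ using (ℕ; zero; suc; z≤n; s≤s)
import Data.Nat.Properties as ℕ
import Data.Nat.Divisibility as ℕ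
import Data.Nat.Tactic.RingSolver as ℕ
open import Data.Nat.Combinatorics using (_C_; nCk+nC[k+1]≡[n+1]C[k+1]; nCk≡nC[n∸k]; nCn≡1; nC1≡n)
open import Data.Nat.Combinatorics.Specification using (k>n⇒nCk≡0)
open import Data.Nat.DivMod using (m*n/n≡m; m≡m%n+[m/n]*n)
open import Data.Nat.Primality using (Prime; euclidsLemma; prime⇒nonZero)
open import Data.Sum.Base using (inj₁; inj₂; [_,_]′)
open import Data.Product.Base using (_×_; _,_; ∃-syntax)
open import Data.Empty using (⊥-elim)
open import Function.Base using (_∘_)
open import Relation.Binary.Definitions using (tri<; tri≈; tri>)
open import Data.Integer.Base as ℤ using (ℤ; +_; -[1+_])
import Data.Integer.Properties as ℤ
open import Data.Integer.Divisibility.Signed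
  using (divides; ∣⇒∣ᵤ; ∣ᵤ⇒∣; ∣m∣n⇒∣m+n; ∣m⇒∣-m; ∣n⇒∣m*n; ∣m⇒∣m*n) renaming (_∣_ to _∣ℤ_)
open import Data.Integer.Tactic.RingSolver using (solve-∀)
open import Relation.Binary.PropositionalEquality
open import Relation.Binary.Bundles using (Setoid)
import Relation.Binary.Reasoning.Setoid as SetoidReasoning
open import Level using (0ℓ)

open import Defs

private
  2[1+k]≡2+2k : ∀ k → 2 ℕ.* suc k ≡ suc (suc (2 ℕ.* k))
  2[1+k]≡2+2k = ℕ.solve-∀

data ParityView : ℕ → Set where
  even : ∀ k → ParityView (2 ℕ.* k)
  odd  : ∀ k → ParityView (suc (2 ℕ.* k))

parityView : ∀ i → ParityView i
parityView zero    = even 0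
parityView (suc i) with parityView i
... | even k = odd k
... | odd  k = subst ParityView (2[1+k]≡2+2k k) (even (suc k))

[1+k]*[1+n]C[1+k]≡[1+n]*nCk : ∀ n k → suc k ℕ.* (suc n C suc k) ≡ suc n ℕ.* (n C k)
[1+k]*[1+n]C[1+k]≡[1+n]*nCk zero    zero    = refl
[1+k]*[1+n]C[1+k]≡[1+n]*nCk zero    (suc k) = ℕ.*-zeroʳ (suc (suc k))
[1+k]*[1+n]C[1+k]≡[1+n]*nCk (suc n) zero    = begin
  1 ℕ.* (suc (suc n) C 1) ≡⟨ ℕ.*-identityˡ _ ⟩
  suc (suc n) C 1         ≡⟨ nC1≡n (suc (suc n)) ⟩
  suc (suc n)             ≡⟨ sym (ℕ.*-identityʳ (suc (suc n))) ⟩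
  suc (suc n) ℕ.* 1       ∎
  where open ≡-Reasoning
[1+k]*[1+n]C[1+k]≡[1+n]*nCk (suc n) (suc k) = begin
  suc (suc k) ℕ.* (suc (suc n) C suc (suc k))
    ≡⟨ cong (suc (suc k) ℕ.*_) (sym (nCk+nC[k+1]≡[n+1]C[k+1] (suc n) (suc k))) ⟩
  suc (suc k) ℕ.* (a ℕ.+ b)
    ≡⟨ expand a b k ⟩
  a ℕ.+ suc k ℕ.* a ℕ.+ suc (suc k) ℕ.* b
    ≡⟨ cong₂ (λ x y → a ℕ.+ x ℕ.+ y) ([1+k]*[1+n]C[1+k]≡[1+n]*nCk n k)
                                     ([1+k]*[1+n]C[1+k]≡[1+n]*nCk n (suc k)) ⟩
  a ℕ.+ suc n ℕ.* (n C k) ℕ.+ suc n ℕ.* (n C suc k)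
    ≡⟨ collect a (n C k) (n C suc k) n ⟩
  a ℕ.+ suc n ℕ.* ((n C k) ℕ.+ (n C suc k))
    ≡⟨ cong (λ c → a ℕ.+ suc n ℕ.* c) (nCk+nC[k+1]≡[n+1]C[k+1] n k) ⟩
  suc (suc n) ℕ.* a
    ∎
  where
  open ≡-Reasoning
  a b : ℕ
  a = suc n C suc k
  b = suc n C suc (suc k)
  expand : ∀ a b k → suc (suc k) ℕ.* (a ℕ.+ b) ≡ a ℕ.+ suc k ℕ.* a ℕ.+ suc (suc k) ℕ.* b
  expand = ℕ.solve-∀
  collect : ∀ a x y n → a ℕ.+ suc n ℕ.* x ℕ.+ suc n ℕ.* y ≡ a ℕ.+ suc n ℕ.* (x ℕ.+ y)
  collect = ℕ.solve-∀

[1+k]*2kC[1+k]≡k*2kCk : ∀ k → suc k ℕ.* ((2 ℕ.* k) C suc k) ≡ k ℕ.* ((2 ℕ.* k) C k)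
[1+k]*2kC[1+k]≡k*2kCk zero    = refl
[1+k]*2kC[1+k]≡k*2kCk (suc k) = begin
  suc (suc k) ℕ.* ((2 ℕ.* suc k) C suc (suc k))
    ≡⟨ cong (λ m → suc (suc k) ℕ.* (m C suc (suc k))) (2[1+k]≡2+2k k) ⟩
  suc (suc k) ℕ.* (suc (suc (2 ℕ.* k)) C suc (suc k))
    ≡⟨ [1+k]*[1+n]C[1+k]≡[1+n]*nCk (suc (2 ℕ.* k)) (suc k) ⟩
  suc (suc (2 ℕ.* k)) ℕ.* (suc (2 ℕ.* k) C suc k)
    ≡⟨ cong (suc (suc (2 ℕ.* k)) ℕ.*_) symmetry ⟩
  suc (suc (2 ℕ.* k)) ℕ.* (suc (2 ℕ.* k) C k)
    ≡⟨ sym ([1+k]*[1+n]C[1+k]≡[1+n]*nCk (suc (2 ℕ.* k)) k) ⟩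
  suc k ℕ.* (suc (suc (2 ℕ.* k)) C suc k)
    ≡⟨ cong (λ m → suc k ℕ.* (m C suc k)) (sym (2[1+k]≡2+2k k)) ⟩
  suc k ℕ.* ((2 ℕ.* suc k) C suc k)
    ∎
  where
  open ≡-Reasoning
  1+2k∸[1+k]≡k : suc (2 ℕ.* k) ℕ.∸ suc k ≡ k
  1+2k∸[1+k]≡k = trans (cong (ℕ._∸ suc k) (1+2k≡k+[1+k] k)) (ℕ.m+n∸n≡m k (suc k))
    where 1+2k≡k+[1+k] : ∀ k → suc (2 ℕ.* k) ≡ k ℕ.+ suc k
          1+2k≡k+[1+k] = ℕ.solve-∀
  symmetry : suc (2 ℕ.* k) C suc k ≡ suc (2 ℕ.* k) C k
  symmetry = trans (nCk≡nC[n∸k] (s≤s (ℕ.m≤m+n k (k ℕ.+ 0)))) (cong (suc (2 ℕ.* k) C_) 1+2k∸[1+k]≡k)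

catalan+2kC[1+k]≡2kCk : ∀ k → catalan k ℕ.+ (2 ℕ.* k) C suc k ≡ (2 ℕ.* k) C k
catalan+2kC[1+k]≡2kCk k = trans (cong (ℕ._+ X) catalan≡Y∸X) (ℕ.m∸n+n≡m X≤Y)
  where
  X Y : ℕ
  X = (2 ℕ.* k) C suc k
  Y = (2 ℕ.* k) C k
  X≤Y : X ℕ.≤ Y
  X≤Y = ℕ.*-cancelˡ-≤ (suc k)
          (subst (ℕ._≤ suc k ℕ.* Y) (sym ([1+k]*2kC[1+k]≡k*2kCk k)) (ℕ.m≤n+m (k ℕ.* Y) Y))
  [1+k]*[Y∸X]≡Y : suc k ℕ.* (Y ℕ.∸ X) ≡ Y
  [1+k]*[Y∸X]≡Y = ℕ.+-cancelʳ-≡ (suc k ℕ.* X) _ _ (begin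
    suc k ℕ.* (Y ℕ.∸ X) ℕ.+ suc k ℕ.* X ≡⟨ sym (ℕ.*-distribˡ-+ (suc k) (Y ℕ.∸ X) X) ⟩
    suc k ℕ.* (Y ℕ.∸ X ℕ.+ X)          ≡⟨ cong (suc k ℕ.*_) (ℕ.m∸n+n≡m X≤Y) ⟩
    suc k ℕ.* Y                        ≡⟨ cong (Y ℕ.+_) (sym ([1+k]*2kC[1+k]≡k*2kCk k)) ⟩
    Y ℕ.+ suc k ℕ.* X                  ∎)
    where open ≡-Reasoning
  catalan≡Y∸X : catalan k ≡ Y ℕ.∸ X
  catalan≡Y∸X = trans (cong (ℕ._/ suc k) (trans (sym [1+k]*[Y∸X]≡Y) (ℕ.*-comm (suc k) (Y ℕ.∸ X))))
                      (m*n/n≡m (Y ℕ.∸ X) (suc k))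

module Congruence (p : ℕ) where
  open import Data.Integer.Base using (_+_; _-_; _*_; -_)

  P : ℤ
  P = + p

  infix 4 _≈_
  record _≈_ (x y : ℤ) : Set where
    constructor ≈-intro
    field P∣x-y : P ∣ℤ x - y

  private
    ≈-by : ∀ {x y} e → x - y ≡ e → P ∣ℤ e → x ≈ y
    ≈-by e eq P∣e = ≈-intro (subst (P ∣ℤ_) (sym eq) P∣e)

  ≡⇒≈ : ∀ {x y} → x ≡ y → x ≈ y
  ≡⇒≈ {x} refl = ≈-intro (divides (+ 0) (ℤ.+-inverseʳ x))

  ≈-refl : ∀ {x} → x ≈ x
  ≈-refl = ≡⇒≈ refl

  ≈-sym : ∀ {x y} → x ≈ y → y ≈ x
  ≈-sym {x} {y} (≈-intro P∣x-y) = ≈-by _ (swap x y) (∣m⇒∣-m P∣x-y)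
    where swap : ∀ x y → y - x ≡ - (x - y)
          swap = solve-∀

  ≈-trans : ∀ {x y z} → x ≈ y → y ≈ z → x ≈ z
  ≈-trans {x} {y} {z} (≈-intro P∣x-y) (≈-intro P∣y-z) =
    ≈-by _ (telescope x y z) (∣m∣n⇒∣m+n P∣x-y P∣y-z)
    where telescope : ∀ x y z → x - z ≡ (x - y) + (y - z)
          telescope = solve-∀

  ≈-setoid : Setoid 0ℓ 0ℓ
  ≈-setoid = record
    { Carrier       = ℤ
    ; _≈_           = _≈_
    ; isEquivalence = record { refl = ≈-refl ; sym = ≈-sym ; trans = ≈-trans }
    }

  module ≈-Reasoning = SetoidReasoning ≈-setoid

  +-cong : ∀ {x x′ y y′} → x ≈ x′ → y ≈ y′ → x + y ≈ x′ + y′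
  +-cong {x} {x′} {y} {y′} (≈-intro P∣x-x′) (≈-intro P∣y-y′) =
    ≈-by _ (split x x′ y y′) (∣m∣n⇒∣m+n P∣x-x′ P∣y-y′)
    where split : ∀ x x′ y y′ → (x + y) - (x′ + y′) ≡ (x - x′) + (y - y′)
          split = solve-∀

  -‿cong : ∀ {x x′} → x ≈ x′ → - x ≈ - x′
  -‿cong {x} {x′} (≈-intro P∣x-x′) = ≈-by _ (split x x′) (∣m⇒∣-m P∣x-x′)
    where split : ∀ x x′ → - x - - x′ ≡ - (x - x′)
          split = solve-∀

  -cong : ∀ {x x′ y y′} → x ≈ x′ → y ≈ y′ → x - y ≈ x′ - y′
  -cong x≈x′ y≈y′ = +-cong x≈x′ (-‿cong y≈y′)

  *-cong : ∀ {x x′ y y′} → x ≈ x′ → y ≈ y′ → x * y ≈ x′ * y′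
  *-cong {x} {x′} {y} {y′} (≈-intro P∣x-x′) (≈-intro P∣y-y′) =
    ≈-by _ (split x x′ y y′) (∣m∣n⇒∣m+n (∣m⇒∣m*n y P∣x-x′) (∣n⇒∣m*n x′ P∣y-y′))
    where split : ∀ x x′ y y′ → x * y - x′ * y′ ≡ (x - x′) * y + x′ * (y - y′)
          split = solve-∀

  *-congˡ : ∀ x {y y′} → y ≈ y′ → x * y ≈ x * y′
  *-congˡ x = *-cong (≈-refl {x})

  m*P≈0 : ∀ m → m * P ≈ + 0
  m*P≈0 m = ≈-by _ (ℤ.+-identityʳ (m * P)) (divides m refl)

  ∣⇒≈0 : ∀ {n} → p ℕ.∣ n → + n ≈ + 0
  ∣⇒≈0 {n} p∣n = ≈-intro (∣ᵤ⇒∣ (subst (p ℕ.∣_) (sym (ℕ.+-identityʳ n)) p∣n))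

  ≈0⇒∣ : ∀ {n} → + n ≈ + 0 → p ℕ.∣ n
  ≈0⇒∣ {n} (≈-intro P∣n-0) = subst (p ℕ.∣_) (ℕ.+-identityʳ n) (∣⇒∣ᵤ P∣n-0)

module FiniteSums where
  open import Data.Integer.Base using (_+_; _-_; _*_; -_)

  sumToℤ : ℕ → (ℕ → ℤ) → ℤ
  sumToℤ zero    f = f 0
  sumToℤ (suc m) f = sumToℤ m f + f (suc m)

  pos-sumTo : ∀ m f → + sumTo m f ≡ sumToℤ m (λ s → + f s)
  pos-sumTo zero    f = refl
  pos-sumTo (suc m) f = trans (ℤ.pos-+ (sumTo m f) (f (suc m))) (cong (_+ + f (suc m)) (pos-sumTo m f))

  sumToℤ-cong : ∀ m {f g} → (∀ s → f s ≡ g s) → sumToℤ m f ≡ sumToℤ m g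
  sumToℤ-cong zero    f≡g = f≡g 0
  sumToℤ-cong (suc m) f≡g = cong₂ _+_ (sumToℤ-cong m f≡g) (f≡g (suc m))

  sumToℤ-distrib-+ : ∀ m f g → sumToℤ m (λ s → f s + g s) ≡ sumToℤ m f + sumToℤ m g
  sumToℤ-distrib-+ zero    f g = refl
  sumToℤ-distrib-+ (suc m) f g =
    trans (cong (_+ (f (suc m) + g (suc m))) (sumToℤ-distrib-+ m f g)) (interchange (sumToℤ m f) (sumToℤ m g) _ _)
    where interchange : ∀ a b c d → (a + b) + (c + d) ≡ (a + c) + (b + d)
          interchange = solve-∀

  sumToℤ-distrib-minus : ∀ m f g → sumToℤ m (λ s → f s - g s) ≡ sumToℤ m f - sumToℤ m g
  sumToℤ-distrib-minus m f g = trans (sumToℤ-distrib-+ m f (λ s → - g s)) (cong (_+_ (sumToℤ m f)) (neg-sum m))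
    where
    neg-sum : ∀ m → sumToℤ m (λ s → - g s) ≡ - sumToℤ m g
    neg-sum zero    = refl
    neg-sum (suc m) = trans (cong (_+ - g (suc m)) (neg-sum m)) (sym (ℤ.neg-distrib-+ (sumToℤ m g) (g (suc m))))

  sumToℤ-head : ∀ m f → sumToℤ (suc m) f ≡ f 0 + sumToℤ m (λ s → f (suc s))
  sumToℤ-head zero    f = refl
  sumToℤ-head (suc m) f = trans (cong (_+ f (suc (suc m))) (sumToℤ-head m f)) (ℤ.+-assoc (f 0) _ _)

  sumToℤ-extend : ∀ m f → (∀ s → m ℕ.< s → f s ≡ + 0) → ∀ d → sumToℤ (d ℕ.+ m) f ≡ sumToℤ m f
  sumToℤ-extend m f f≡0 zero    = refl
  sumToℤ-extend m f f≡0 (suc d) = begin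
    sumToℤ (d ℕ.+ m) f + f (suc (d ℕ.+ m)) ≡⟨ cong (_+_ (sumToℤ (d ℕ.+ m) f)) (f≡0 _ (s≤s (ℕ.m≤n+m m d))) ⟩
    sumToℤ (d ℕ.+ m) f + + 0               ≡⟨ ℤ.+-identityʳ _ ⟩
    sumToℤ (d ℕ.+ m) f                     ≡⟨ sumToℤ-extend m f f≡0 d ⟩
    sumToℤ m f                             ∎
    where open ≡-Reasoning

  sumToℤ-pairs : ∀ m f → sumToℤ (suc (2 ℕ.* m)) f ≡ sumToℤ m (λ k → f (2 ℕ.* k) + f (suc (2 ℕ.* k)))
  sumToℤ-pairs zero    f = refl
  sumToℤ-pairs (suc m) f = begin
    sumToℤ (suc (2 ℕ.* suc m)) f
      ≡⟨ cong (λ i → sumToℤ (suc i) f) (2[1+k]≡2+2k m) ⟩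
    sumToℤ (suc 2m) f + f (2 ℕ.+ 2m) + f (3 ℕ.+ 2m)
      ≡⟨ cong (λ x → x + f (2 ℕ.+ 2m) + f (3 ℕ.+ 2m)) (sumToℤ-pairs m f) ⟩
    S + f (2 ℕ.+ 2m) + f (3 ℕ.+ 2m)
      ≡⟨ ℤ.+-assoc S _ _ ⟩
    S + (f (2 ℕ.+ 2m) + f (3 ℕ.+ 2m))
      ≡⟨ cong (λ i → S + (f i + f (suc i))) (sym (2[1+k]≡2+2k m)) ⟩
    S + (f (2 ℕ.* suc m) + f (suc (2 ℕ.* suc m)))
      ∎
    where
    open ≡-Reasoning
    2m : ℕ
    2m = 2 ℕ.* m
    S : ℤ
    S = sumToℤ m (λ k → f (2 ℕ.* k) + f (suc (2 ℕ.* k)))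

  sumToℤ-Pascal : ∀ n (g : ℕ → ℤ) → sumToℤ (suc n) (λ s → + (suc n C s) * g s)
                        ≡ sumToℤ n (λ s → + (n C s) * g s) + sumToℤ n (λ s → + (n C s) * g (suc s))
  sumToℤ-Pascal n g = begin
    sumToℤ (suc n) (λ s → + (suc n C s) * g s)
      ≡⟨ sumToℤ-head n (λ s → + (suc n C s) * g s) ⟩
    g₀ + sumToℤ n (λ s → + (suc n C suc s) * g (suc s))
      ≡⟨ cong (_+_ g₀) (sumToℤ-cong n Pascal) ⟩
    g₀ + sumToℤ n (λ s → + (n C s) * g (suc s) + + (n C suc s) * g (suc s))
      ≡⟨ cong (_+_ g₀) (sumToℤ-distrib-+ n (λ s → + (n C s) * g (suc s)) (λ s → + (n C suc s) * g (suc s))) ⟩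
    g₀ + (Shifted + sumToℤ n (λ s → + (n C suc s) * g (suc s)))
      ≡⟨ swap g₀ Shifted _ ⟩
    (g₀ + sumToℤ n (λ s → + (n C suc s) * g (suc s))) + Shifted
      ≡⟨ cong (_+ Shifted) (sym (sumToℤ-head n (λ s → + (n C s) * g s))) ⟩
    sumToℤ (suc n) (λ s → + (n C s) * g s) + Shifted
      ≡⟨ cong (_+ Shifted) (sumToℤ-extend n (λ s → + (n C s) * g s) beyond 1) ⟩
    sumToℤ n (λ s → + (n C s) * g s) + Shifted
      ∎
    where
    open ≡-Reasoning
    g₀ Shifted : ℤ
    g₀ = + 1 * g 0
    Shifted = sumToℤ n (λ s → + (n C s) * g (suc s))
    Pascal : ∀ s → + (suc n C suc s) * g (suc s) ≡ + (n C s) * g (suc s) + + (n C suc s) * g (suc s)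
    Pascal s = begin
      + (suc n C suc s) * g (suc s)
        ≡⟨ cong (λ c → + c * g (suc s)) (sym (nCk+nC[k+1]≡[n+1]C[k+1] n s)) ⟩
      + (n C s ℕ.+ n C suc s) * g (suc s)
        ≡⟨ cong (_* g (suc s)) (ℤ.pos-+ (n C s) (n C suc s)) ⟩
      (+ (n C s) + + (n C suc s)) * g (suc s)
        ≡⟨ ℤ.*-distribʳ-+ (g (suc s)) (+ (n C s)) (+ (n C suc s)) ⟩
      + (n C s) * g (suc s) + + (n C suc s) * g (suc s)
        ∎
    beyond : ∀ s → n ℕ.< s → + (n C s) * g s ≡ + 0
    beyond s n<s = cong (λ c → + c * g s) (k>n⇒nCk≡0 n<s)
    swap : ∀ a b c → a + (b + c) ≡ (a + c) + b
    swap = solve-∀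

module Trinomials where
  open import Data.Integer.Base using (_+_; _-_; _*_; -_)
  open FiniteSums

  -- E s j = [xʲ] (1 + x²)ˢ; T and E take integer exponents j and vanish for j < 0.
  T : ℕ → ℤ → ℤ
  T zero    (+ zero) = + 1
  T zero    _        = + 0
  T (suc n) j        = T n j + T n (j - + 1) + T n (j - + 2)

  E : ℕ → ℤ → ℤ
  E zero    (+ zero) = + 1
  E zero    _        = + 0
  E (suc s) j        = E s j + E s (j - + 2)

  T-negative : ∀ n m → T n -[1+ m ] ≡ + 0
  T-negative zero    m = refl
  T-negative (suc n) m =
    cong₂ _+_ (cong₂ _+_ (T-negative n m) (T-negative n _)) (T-negative n _)

  E-negative : ∀ s m → E s -[1+ m ] ≡ + 0
  E-negative zero    m = refl
  E-negative (suc s) m = cong₂ _+_ (E-negative s m) (E-negative s _)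

  T-zero : ∀ n → T n (+ 0) ≡ + 1
  T-zero zero    = refl
  T-zero (suc n) = cong₂ _+_ (cong₂ _+_ (T-zero n) (T-negative n 0)) (T-negative n 1)

  T-vanish : ∀ n i → 2 ℕ.* n ℕ.< i → T n (+ i) ≡ + 0
  T-vanish zero    (suc i)       _        = refl
  T-vanish (suc n) (suc zero)    (s≤s ())
  T-vanish (suc n) (suc (suc i)) 2n+2<i+2 = cong₂ _+_ (cong₂ _+_ (vanish 2) (vanish 1)) (vanish 0)
    where
    2n<i : 2 ℕ.* n ℕ.< i
    2n<i = ℕ.≤-pred (ℕ.≤-pred (subst (ℕ._< 2 ℕ.+ i) (ℕ.*-suc 2 n) 2n+2<i+2))
    vanish : ∀ k → T n (+ (k ℕ.+ i)) ≡ + 0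
    vanish k = T-vanish n (k ℕ.+ i) (ℕ.<-≤-trans 2n<i (ℕ.m≤n+m i k))

  E-even : ∀ s k → E s (+ (2 ℕ.* k)) ≡ + (s C k)
  E-odd  : ∀ s k → E s (+ suc (2 ℕ.* k)) ≡ + 0
  E-even zero    zero    = refl
  E-even zero    (suc k) = cong (λ i → E 0 (+ i)) (2[1+k]≡2+2k k)
  E-even (suc s) zero    = cong₂ _+_ (E-even s 0) (E-negative s 1)
  E-even (suc s) (suc k) = begin
    E (suc s) (+ (2 ℕ.* suc k))
      ≡⟨ cong (λ i → E (suc s) (+ i)) (2[1+k]≡2+2k k) ⟩
    E s (+ suc (suc (2 ℕ.* k))) + E s (+ (2 ℕ.* k))
      ≡⟨ cong₂ _+_ (trans (cong (λ i → E s (+ i)) (sym (2[1+k]≡2+2k k))) (E-even s (suc k))) (E-even s k) ⟩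
    + (s C suc k) + + (s C k)
      ≡⟨ cong +_ (trans (ℕ.+-comm (s C suc k) (s C k)) (nCk+nC[k+1]≡[n+1]C[k+1] s k)) ⟩
    + (suc s C suc k)
      ∎
    where open ≡-Reasoning
  E-odd zero    k       = refl
  E-odd (suc s) zero    = cong₂ _+_ (E-odd s 0) (E-negative s 0)
  E-odd (suc s) (suc k) = begin
    E (suc s) (+ suc (2 ℕ.* suc k))
      ≡⟨ cong (λ i → E (suc s) (+ suc i)) (2[1+k]≡2+2k k) ⟩
    E s (+ suc (suc (suc (2 ℕ.* k)))) + E s (+ suc (2 ℕ.* k))
      ≡⟨ cong₂ _+_ (trans (cong (λ i → E s (+ suc i)) (sym (2[1+k]≡2+2k k))) (E-odd s (suc k))) (E-odd s k) ⟩
    + 0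
      ∎
    where open ≡-Reasoning

  E₀≡T₀ : ∀ j → E 0 j ≡ T 0 j
  E₀≡T₀ (+ zero)  = refl
  E₀≡T₀ (+ suc i) = refl
  E₀≡T₀ -[1+ i ]  = refl

  T-expansion : ∀ n j → T n j ≡ sumToℤ n (λ s → + (n C s) * E s (j - + n + + s))
  T-expansion zero    j = sym (begin
    + 1 * E 0 (j - + 0 + + 0) ≡⟨ ℤ.*-identityˡ _ ⟩
    E 0 (j - + 0 + + 0)       ≡⟨ cong (E 0) (index j) ⟩
    E 0 j                     ≡⟨ E₀≡T₀ j ⟩
    T 0 j                     ∎)
    where
    open ≡-Reasoning
    index : ∀ j → j - + 0 + + 0 ≡ j
    index = solve-∀
  T-expansion (suc n) j = begin
    T n j + T n (j - + 1) + T n (j - + 2)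
      ≡⟨ cong₂ _+_ (cong₂ _+_ (T-expansion n j) (T-expansion n (j - + 1))) (T-expansion n (j - + 2)) ⟩
    S j + S (j - + 1) + S (j - + 2)
      ≡⟨ regroup (S j) (S (j - + 1)) (S (j - + 2)) ⟩
    (S j + S (j - + 2)) + S (j - + 1)
      ≡⟨ cong₂ _+_ (trans (sym (sumToℤ-distrib-+ n _ _)) (sumToℤ-cong n step)) (sumToℤ-cong n shift) ⟩
    sumToℤ n (λ s → + (n C s) * g (suc s)) + sumToℤ n (λ s → + (n C s) * g s)
      ≡⟨ ℤ.+-comm (sumToℤ n (λ s → + (n C s) * g (suc s))) _ ⟩
    sumToℤ n (λ s → + (n C s) * g s) + sumToℤ n (λ s → + (n C s) * g (suc s))
      ≡⟨ sym (sumToℤ-Pascal n g) ⟩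
    sumToℤ (suc n) (λ s → + (suc n C s) * g s)
      ∎
    where
    open ≡-Reasoning
    S : ℤ → ℤ
    S i = sumToℤ n (λ s → + (n C s) * E s (i - + n + + s))
    g : ℕ → ℤ
    g s = E s (j - + suc n + + s)
    regroup : ∀ a b c → a + b + c ≡ (a + c) + b
    regroup = solve-∀
    index₁ : ∀ j N s → (j - + 1) - N + s ≡ j - (+ 1 + N) + s
    index₁ = solve-∀
    index₂ : ∀ j N s → j - (+ 1 + N) + (+ 1 + s) ≡ j - N + s
    index₂ = solve-∀
    index₃ : ∀ j N s → (j - + 2) - N + s ≡ (j - N + s) - + 2
    index₃ = solve-∀
    shift : ∀ s → + (n C s) * E s ((j - + 1) - + n + + s) ≡ + (n C s) * g s
    shift s = cong (λ i → + (n C s) * E s i) (index₁ j (+ n) (+ s))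
    step : ∀ s → + (n C s) * E s (j - + n + + s) + + (n C s) * E s ((j - + 2) - + n + + s)
               ≡ + (n C s) * g (suc s)
    step s = begin
      + (n C s) * E s i + + (n C s) * E s ((j - + 2) - + n + + s)
        ≡⟨ cong (λ k → + (n C s) * E s i + + (n C s) * E s k) (index₃ j (+ n) (+ s)) ⟩
      + (n C s) * E s i + + (n C s) * E s (i - + 2)
        ≡⟨ sym (ℤ.*-distribˡ-+ (+ (n C s)) (E s i) (E s (i - + 2))) ⟩
      + (n C s) * E (suc s) i
        ≡⟨ cong (λ k → + (n C s) * E (suc s) k) (sym (index₂ j (+ n) (+ s))) ⟩
      + (n C s) * g (suc s)
        ∎
      where i = j - + n + + s

  diagonal : ℕ → ℕ → ℤ
  diagonal d n = T n (+ (d ℕ.+ n))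

  diagonal-expansion : ∀ d n → diagonal d n ≡ sumToℤ n (λ s → + (n C s) * E s (+ (d ℕ.+ s)))
  diagonal-expansion d n = trans (T-expansion n (+ (d ℕ.+ n))) (sumToℤ-cong n (λ s →
    cong (λ i → + (n C s) * E s i) (begin
      + (d ℕ.+ n) - + n + + s   ≡⟨ cong (λ i → i - + n + + s) (ℤ.pos-+ d n) ⟩
      + d + + n - + n + + s     ≡⟨ cancel (+ d) (+ n) (+ s) ⟩
      + d + + s                 ≡⟨ sym (ℤ.pos-+ d s) ⟩
      + (d ℕ.+ s)               ∎)))
    where
    open ≡-Reasoning
    cancel : ∀ d n s → d + n - n + s ≡ d + s
    cancel = solve-∀

  E[2k,2k]-E[2k,2+2k]≡catalan : ∀ k → E (2 ℕ.* k) (+ (2 ℕ.* k)) - E (2 ℕ.* k) (+ (2 ℕ.+ 2 ℕ.* k)) ≡ + catalan k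
  E[2k,2k]-E[2k,2+2k]≡catalan k = begin
    E (2 ℕ.* k) (+ (2 ℕ.* k)) - E (2 ℕ.* k) (+ (2 ℕ.+ 2 ℕ.* k))
      ≡⟨ cong₂ _-_ (E-even (2 ℕ.* k) k)
                   (trans (cong (λ i → E (2 ℕ.* k) (+ i)) (sym (2[1+k]≡2+2k k))) (E-even (2 ℕ.* k) (suc k))) ⟩
    + Y - + X
      ≡⟨ cong (_- + X) (trans (cong +_ (sym (catalan+2kC[1+k]≡2kCk k))) (ℤ.pos-+ (catalan k) X)) ⟩
    + catalan k + + X - + X
      ≡⟨ cancel (+ catalan k) (+ X) ⟩
    + catalan k
      ∎
    where
    open ≡-Reasoning
    X Y : ℕ
    X = (2 ℕ.* k) C suc k
    Y = (2 ℕ.* k) C k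
    cancel : ∀ a x → a + x - x ≡ a
    cancel = solve-∀

  E[1+2k,1+2k]-E[1+2k,3+2k]≡0 : ∀ k →
    E (suc (2 ℕ.* k)) (+ suc (2 ℕ.* k)) - E (suc (2 ℕ.* k)) (+ (2 ℕ.+ suc (2 ℕ.* k))) ≡ + 0
  E[1+2k,1+2k]-E[1+2k,3+2k]≡0 k = cong₂ _-_ (E-odd (suc (2 ℕ.* k)) k)
    (trans (cong (λ i → E (suc (2 ℕ.* k)) (+ suc i)) (sym (2[1+k]≡2+2k k))) (E-odd (suc (2 ℕ.* k)) (suc k)))

  motzkin≡diagonal₀-diagonal₂ : ∀ n → + motzkin n ≡ diagonal 0 n - diagonal 2 n
  motzkin≡diagonal₀-diagonal₂ n = sym (begin
    diagonal 0 n - diagonal 2 n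
      ≡⟨ cong₂ _-_ (diagonal-expansion 0 n) (diagonal-expansion 2 n) ⟩
    sumToℤ n (λ s → + (n C s) * E s (+ s)) - sumToℤ n (λ s → + (n C s) * E s (+ (2 ℕ.+ s)))
      ≡⟨ sym (sumToℤ-distrib-minus n _ _) ⟩
    sumToℤ n (λ s → + (n C s) * E s (+ s) - + (n C s) * E s (+ (2 ℕ.+ s)))
      ≡⟨ sumToℤ-cong n (λ s → factor (+ (n C s)) (E s (+ s)) (E s (+ (2 ℕ.+ s)))) ⟩
    sumToℤ n h
      ≡⟨ sym (sumToℤ-extend n h h-beyond (suc n)) ⟩
    sumToℤ (suc n ℕ.+ n) h
      ≡⟨ cong (λ m → sumToℤ m h) (1+n+n≡1+2n n) ⟩
    sumToℤ (suc (2 ℕ.* n)) h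
      ≡⟨ sumToℤ-pairs n h ⟩
    sumToℤ n (λ k → h (2 ℕ.* k) + h (suc (2 ℕ.* k)))
      ≡⟨ sumToℤ-cong n (λ k → cong₂ _+_ (h-even k) (h-odd k)) ⟩
    sumToℤ n (λ k → + (n C (2 ℕ.* k)) * + catalan k + + (n C suc (2 ℕ.* k)) * + 0)
      ≡⟨ sumToℤ-cong n (λ k → drop (+ (n C (2 ℕ.* k)) * + catalan k) (+ (n C suc (2 ℕ.* k)))) ⟩
    sumToℤ n (λ k → + (n C (2 ℕ.* k)) * + catalan k)
      ≡⟨ sumToℤ-cong n (λ k → sym (ℤ.pos-* (n C (2 ℕ.* k)) (catalan k))) ⟩
    sumToℤ n (λ k → + ((n C (2 ℕ.* k)) ℕ.* catalan k))
      ≡⟨ sym (pos-sumTo n (λ k → (n C (2 ℕ.* k)) ℕ.* catalan k)) ⟩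
    + motzkin n
      ∎)
    where
    open ≡-Reasoning
    h : ℕ → ℤ
    h s = + (n C s) * (E s (+ s) - E s (+ (2 ℕ.+ s)))
    1+n+n≡1+2n : ∀ n → suc n ℕ.+ n ≡ suc (2 ℕ.* n)
    1+n+n≡1+2n = ℕ.solve-∀
    h-beyond : ∀ s → n ℕ.< s → h s ≡ + 0
    h-beyond s n<s rewrite k>n⇒nCk≡0 n<s = refl
    h-even : ∀ k → h (2 ℕ.* k) ≡ + (n C (2 ℕ.* k)) * + catalan k
    h-even k = cong (+ (n C (2 ℕ.* k)) *_) (E[2k,2k]-E[2k,2+2k]≡catalan k)
    h-odd : ∀ k → h (suc (2 ℕ.* k)) ≡ + (n C suc (2 ℕ.* k)) * + 0
    h-odd k = cong (+ (n C suc (2 ℕ.* k)) *_) (E[1+2k,1+2k]-E[1+2k,3+2k]≡0 k)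
    factor : ∀ c x y → c * x - c * y ≡ c * (x - y)
    factor = solve-∀
    drop : ∀ x c → x + c * + 0 ≡ x
    drop = solve-∀

  -- ψ k i = [xⁱ] (1 + x + x²)⁻ᵏ, computed from (1 - x³) · (1 + x + x²)⁻ᵏ⁻¹ = (1 - x) · (1 + x + x²)⁻ᵏ.
  ψ : ℕ → ℕ → ℤ
  ψ zero    i                   = T 0 (+ i)
  ψ (suc k) 0                   = ψ k 0
  ψ (suc k) 1                   = ψ k 1 - ψ k 0
  ψ (suc k) 2                   = ψ k 2 - ψ k 1
  ψ (suc k) (suc (suc (suc i))) = ψ (suc k) i + (ψ k (3 ℕ.+ i) - ψ k (2 ℕ.+ i))

  Ψ : ℕ → ℤ → ℤ
  Ψ k (+ i)    = ψ k i
  Ψ k -[1+ _ ] = + 0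

  Ψ₀≡T₀ : ∀ j → Ψ 0 j ≡ T 0 j
  Ψ₀≡T₀ (+ i)    = refl
  Ψ₀≡T₀ -[1+ i ] = refl

  Ψ-suc : ∀ k j → Ψ (suc k) j ≡ Ψ (suc k) (j - + 3) + (Ψ k j - Ψ k (j - + 1))
  Ψ-suc k (+ 0)                   = sym (trans (ℤ.+-identityˡ _) (ℤ.+-identityʳ _))
  Ψ-suc k (+ 1)                   = sym (ℤ.+-identityˡ _)
  Ψ-suc k (+ 2)                   = sym (ℤ.+-identityˡ _)
  Ψ-suc k (+ suc (suc (suc i)))   = refl
  Ψ-suc k -[1+ m ]                = refl

  T-diff : ∀ n j → T n j ≡ T n (j - + 3) + (T (suc n) j - T (suc n) (j - + 1))
  T-diff n j = begin
    T n j
      ≡⟨ telescope (T n j) (T n (j - + 1)) (T n (j - + 2)) (T n (j - + 3)) ⟩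
    T n (j - + 3) + (T n j + T n (j - + 1) + T n (j - + 2) - (T n (j - + 1) + T n (j - + 2) + T n (j - + 3)))
      ≡⟨ cong₂ (λ x y → T n (j - + 3) + (T (suc n) j - (T n (j - + 1) + T n x + T n y))) (lower₁ j) (lower₂ j) ⟩
    T n (j - + 3) + (T (suc n) j - T (suc n) (j - + 1))
      ∎
    where
    open ≡-Reasoning
    telescope : ∀ a b c d → a ≡ d + (a + b + c - (b + c + d))
    telescope = solve-∀
    lower₁ : ∀ j → j - + 2 ≡ j - + 1 - + 1
    lower₁ = solve-∀
    lower₂ : ∀ j → j - + 3 ≡ j - + 1 - + 2
    lower₂ = solve-∀

  private
    3[1+m]+i : ∀ m i → 3 ℕ.* suc m ℕ.+ i ≡ 3 ℕ.+ (3 ℕ.* m ℕ.+ i)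
    3[1+m]+i = ℕ.solve-∀
    2+[3m+i] : ∀ m i → 2 ℕ.+ (3 ℕ.* m ℕ.+ i) ≡ 3 ℕ.* m ℕ.+ (2 ℕ.+ i)
    2+[3m+i] = ℕ.solve-∀

  ψ₁-periodic : ∀ m i → ψ 1 (3 ℕ.* m ℕ.+ i) ≡ ψ 1 i
  ψ₁-periodic zero    i = refl
  ψ₁-periodic (suc m) i = begin
    ψ 1 (3 ℕ.* suc m ℕ.+ i)             ≡⟨ cong (ψ 1) (3[1+m]+i m i) ⟩
    ψ 1 (3 ℕ.* m ℕ.+ i) + (+ 0 - + 0)   ≡⟨ ℤ.+-identityʳ _ ⟩
    ψ 1 (3 ℕ.* m ℕ.+ i)                 ≡⟨ ψ₁-periodic m i ⟩
    ψ 1 i                               ∎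
    where open ≡-Reasoning

  ψ₂-linear : ∀ m i → ψ 2 (3 ℕ.* m ℕ.+ i) ≡ ψ 2 i + + m * (ψ 1 i - ψ 1 (2 ℕ.+ i))
  ψ₂-linear zero    i = sym (ℤ.+-identityʳ _)
  ψ₂-linear (suc m) i = begin
    ψ 2 (3 ℕ.* suc m ℕ.+ i)
      ≡⟨ cong (ψ 2) (3[1+m]+i m i) ⟩
    ψ 2 (3 ℕ.* m ℕ.+ i) + (ψ 1 (3 ℕ.+ (3 ℕ.* m ℕ.+ i)) - ψ 1 (2 ℕ.+ (3 ℕ.* m ℕ.+ i)))
      ≡⟨ cong₂ (λ x y → x + (ψ 1 y - ψ 1 (2 ℕ.+ (3 ℕ.* m ℕ.+ i)))) (ψ₂-linear m i) (sym (3[1+m]+i m i)) ⟩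
    ψ 2 i + + m * δ + (ψ 1 (3 ℕ.* suc m ℕ.+ i) - ψ 1 (2 ℕ.+ (3 ℕ.* m ℕ.+ i)))
      ≡⟨ cong₂ (λ x y → ψ 2 i + + m * δ + (x - ψ 1 y)) (ψ₁-periodic (suc m) i) (2+[3m+i] m i) ⟩
    ψ 2 i + + m * δ + (ψ 1 i - ψ 1 (3 ℕ.* m ℕ.+ (2 ℕ.+ i)))
      ≡⟨ cong (λ x → ψ 2 i + + m * δ + (ψ 1 i - x)) (ψ₁-periodic m (2 ℕ.+ i)) ⟩
    ψ 2 i + + m * δ + δ
      ≡⟨ collect (ψ 2 i) (+ m) δ ⟩
    ψ 2 i + + suc m * δ
      ∎
    where
    open ≡-Reasoning
    δ : ℤ
    δ = ψ 1 i - ψ 1 (2 ℕ.+ i)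
    collect : ∀ x m δ → x + m * δ + δ ≡ x + (+ 1 + m) * δ
    collect = solve-∀

  ψ₃-residue₀ : ∀ m → ψ 3 (3 ℕ.* m ℕ.+ 0) ≡ + suc m
  ψ₃-residue₀ zero    = refl
  ψ₃-residue₀ (suc m) = begin
    ψ 3 (3 ℕ.* suc m ℕ.+ 0)
      ≡⟨ cong (ψ 3) (3[1+m]+i m 0) ⟩
    ψ 3 (3 ℕ.* m ℕ.+ 0) + (ψ 2 (3 ℕ.+ (3 ℕ.* m ℕ.+ 0)) - ψ 2 (2 ℕ.+ (3 ℕ.* m ℕ.+ 0)))
      ≡⟨ cong₂ (λ x y → ψ 3 (3 ℕ.* m ℕ.+ 0) + (ψ 2 x - ψ 2 y)) (sym (3[1+m]+i m 0)) (2+[3m+i] m 0) ⟩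
    ψ 3 (3 ℕ.* m ℕ.+ 0) + (ψ 2 (3 ℕ.* suc m ℕ.+ 0) - ψ 2 (3 ℕ.* m ℕ.+ 2))
      ≡⟨ cong₂ (λ x y → x + y) (ψ₃-residue₀ m) (cong₂ _-_ (ψ₂-linear (suc m) 0) (ψ₂-linear m 2)) ⟩
    + suc m + ((+ 1 + + suc m * + 1) - (+ 1 + + m * + 1))
      ≡⟨ simplify (+ m) ⟩
    + suc (suc m)
      ∎
    where
    open ≡-Reasoning
    simplify : ∀ m → (+ 1 + m) + ((+ 1 + (+ 1 + m) * + 1) - (+ 1 + m * + 1)) ≡ + 1 + (+ 1 + m)
    simplify = solve-∀

  ψ₃-residue₂ : ∀ m → + 2 * ψ 3 (3 ℕ.* m ℕ.+ 2) ≡ + 3 * (+ suc m * + suc (suc m))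
  ψ₃-residue₂ zero    = refl
  ψ₃-residue₂ (suc m) = begin
    + 2 * ψ 3 (3 ℕ.* suc m ℕ.+ 2)
      ≡⟨ cong (λ i → + 2 * ψ 3 i) (3[1+m]+i m 2) ⟩
    + 2 * (ψ 3 (3 ℕ.* m ℕ.+ 2) + (ψ 2 (3 ℕ.+ (3 ℕ.* m ℕ.+ 2)) - ψ 2 (2 ℕ.+ (3 ℕ.* m ℕ.+ 2))))
      ≡⟨ cong₂ (λ x y → + 2 * (ψ 3 (3 ℕ.* m ℕ.+ 2) + (ψ 2 x - ψ 2 y))) (sym (3[1+m]+i m 2)) (2+[3m+i] m 2) ⟩
    + 2 * (ψ 3 (3 ℕ.* m ℕ.+ 2) + (ψ 2 (3 ℕ.* suc m ℕ.+ 2) - ψ 2 (3 ℕ.* m ℕ.+ 4)))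
      ≡⟨ cong (λ x → + 2 * (ψ 3 (3 ℕ.* m ℕ.+ 2) + x)) (cong₂ _-_ (ψ₂-linear (suc m) 2) (ψ₂-linear m 4)) ⟩
    + 2 * (ψ 3 (3 ℕ.* m ℕ.+ 2) + ((+ 1 + + suc m * + 1) - (- + 4 + + m * - + 2)))
      ≡⟨ distrib (ψ 3 (3 ℕ.* m ℕ.+ 2)) (+ m) ⟩
    + 2 * ψ 3 (3 ℕ.* m ℕ.+ 2) + + 6 * (+ 2 + + m)
      ≡⟨ cong (λ x → x + + 6 * (+ 2 + + m)) (ψ₃-residue₂ m) ⟩
    + 3 * (+ suc m * + suc (suc m)) + + 6 * (+ 2 + + m)
      ≡⟨ simplify (+ m) ⟩
    + 3 * (+ suc (suc m) * + suc (suc (suc m)))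
      ∎
    where
    open ≡-Reasoning
    distrib : ∀ x m → + 2 * (x + ((+ 1 + (+ 1 + m) * + 1) - (- + 4 + m * - + 2))) ≡ + 2 * x + + 6 * (+ 2 + m)
    distrib = solve-∀
    simplify : ∀ m → + 3 * ((+ 1 + m) * (+ 2 + m)) + + 6 * (+ 2 + m) ≡ + 3 * ((+ 2 + m) * (+ 3 + m))
    simplify = solve-∀

module TrinomialsModPrime (p : ℕ) (p-prime : Prime p) where
  open import Data.Integer.Base using (_+_; _-_; _*_; -_)
  open Congruence p
  open FiniteSums
  open Trinomials

  private instance
    p≢0 : ℕ.NonZero p
    p≢0 = prime⇒nonZero p-prime

  p∣pCk : ∀ k → 0 ℕ.< k → k ℕ.< p → p ℕ.∣ p C k
  p∣pCk (suc s) _ s<p with euclidsLemma (suc s) (p C suc s) p-prime p∣[1+s]*pC[1+s]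
    where
    p∣[1+s]*pC[1+s] : p ℕ.∣ suc s ℕ.* (p C suc s)
    p∣[1+s]*pC[1+s] = ℕ.divides (ℕ.pred p C s) (begin
      suc s ℕ.* (p C suc s)              ≡⟨ cong (λ m → suc s ℕ.* (m C suc s)) (sym (ℕ.suc-pred p)) ⟩
      suc s ℕ.* (suc (ℕ.pred p) C suc s) ≡⟨ [1+k]*[1+n]C[1+k]≡[1+n]*nCk (ℕ.pred p) s ⟩
      suc (ℕ.pred p) ℕ.* (ℕ.pred p C s)  ≡⟨ cong (ℕ._* (ℕ.pred p C s)) (ℕ.suc-pred p) ⟩
      p ℕ.* (ℕ.pred p C s)               ≡⟨ ℕ.*-comm p _ ⟩
      (ℕ.pred p C s) ℕ.* p               ∎)
      where open ≡-Reasoning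
  ... | inj₁ p∣1+s  = ⊥-elim (ℕ.<⇒≱ s<p (ℕ.∣⇒≤ p∣1+s))
  ... | inj₂ p∣pC1+s = p∣pC1+s

  T₀-≢0 : ∀ {j} → j ≢ + 0 → T 0 j ≡ + 0
  T₀-≢0 {+ zero}  j≢0 = ⊥-elim (j≢0 refl)
  T₀-≢0 {+ suc i} j≢0 = refl
  T₀-≢0 { -[1+ i ]} j≢0 = refl

  private
    index-2P : ∀ i → + i - P - P ≡ + i - + (2 ℕ.* p)
    index-2P i = trans (minus-twice (+ i) P) (cong (λ m → + i - m) (sym (ℤ.pos-* 2 p)))
      where minus-twice : ∀ x P → x - P - P ≡ x - + 2 * P
            minus-twice = solve-∀

  T₀[i-2P] : ∀ {i} → i ≢ 2 ℕ.* p → T 0 (+ i - P - P) ≡ + 0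
  T₀[i-2P] {i} i≢2p = T₀-≢0 (λ i-2P≡0 →
    i≢2p (ℤ.+-injective (ℤ.i-j≡0⇒i≡j (+ i) _ (trans (sym (index-2P i)) i-2P≡0))))

  T₀[2p-2P] : T 0 (+ (2 ℕ.* p) - P - P) ≡ + 1
  T₀[2p-2P] = cong (T 0) (trans (index-2P (2 ℕ.* p)) (ℤ.+-inverseʳ (+ (2 ℕ.* p))))

  private
    both-sides : ∀ {i v} → E p (+ i) ≈ v → T 0 (+ i) + T 0 (+ i - P - P) ≡ v →
                 E p (+ i) ≈ T 0 (+ i) + T 0 (+ i - P - P)
    both-sides E≈v T≡v = ≈-trans E≈v (≡⇒≈ (sym T≡v))

  E-prime : ∀ j → E p j ≈ T 0 j + T 0 (j - P - P)
  E-prime -[1+ m ] = ≡⇒≈ (begin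
    E p -[1+ m ]                 ≡⟨ E-negative p m ⟩
    + 0                          ≡⟨ cong (T 0) (sym index) ⟩
    T 0 (-[1+ m ] - P - P)       ≡⟨ sym (ℤ.+-identityˡ _) ⟩
    + 0 + T 0 (-[1+ m ] - P - P) ∎)
    where
    open ≡-Reasoning
    index : -[1+ m ] - P - P ≡ -[1+ p ℕ.+ (p ℕ.+ m) ]
    index = trans (cong (_- P) (ℤ.neg-minus-pos m p)) (ℤ.neg-minus-pos (p ℕ.+ m) p)
  E-prime (+ i) with parityView i
  ... | odd k        = both-sides (≡⇒≈ (E-odd p k)) (cong (_+_ (+ 0)) (T₀[i-2P] (ℕ.even≢odd p k ∘ sym)))
  ... | even zero    = both-sides (≡⇒≈ (E-even p 0))
                                  (cong (_+_ (+ 1)) (T₀[i-2P] (ℕ.≢-nonZero⁻¹ p ∘ ℕ.m+n≡0⇒m≡0 p ∘ sym)))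
  ... | even (suc k) with ℕ.<-cmp (suc k) p
  ...   | tri< k<p _ _  = both-sides (≈-trans (≡⇒≈ (E-even p (suc k))) (∣⇒≈0 (p∣pCk (suc k) (s≤s z≤n) k<p)))
                                     (cong (_+_ (+ 0)) (T₀[i-2P] (ℕ.<⇒≢ k<p ∘ ℕ.*-cancelˡ-≡ _ _ 2)))
  ...   | tri≈ _ refl _ = both-sides (≡⇒≈ (trans (E-even p (suc k)) (cong +_ (nCn≡1 (suc k)))))
                                     (cong (_+_ (+ 0)) T₀[2p-2P])
  ...   | tri> _ _ p<k  = both-sides (≡⇒≈ (trans (E-even p (suc k)) (cong +_ (k>n⇒nCk≡0 p<k))))
                                     (cong (_+_ (+ 0)) (T₀[i-2P] (ℕ.>⇒≢ p<k ∘ ℕ.*-cancelˡ-≡ _ _ 2)))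

  -- spread f j is the coefficient of xʲ in (1 + xᵖ + x²ᵖ) · Σ f(i) xⁱ.
  spread : (ℤ → ℤ) → ℤ → ℤ
  spread f j = f j + f (j - P) + f (j - P - P)

  T-prime : ∀ j → T p j ≈ spread (T 0) j
  T-prime j = begin
    T p j                                    ≡⟨ T-expansion p j ⟩
    sumToℤ p F                               ≡⟨ cong (λ m → sumToℤ m F) (sym (ℕ.suc-pred p)) ⟩
    sumToℤ (ℕ.pred p) F + F (suc (ℕ.pred p)) ≈⟨ +-cong (inner (ℕ.pred p) pred[p]<p) (≡⇒≈ (cong F (ℕ.suc-pred p))) ⟩
    F 0 + F p                                ≡⟨ cong₂ _+_ F₀≡T₀ Fₚ≡Eₚ ⟩
    T 0 (j - P) + E p j                      ≈⟨ +-cong (≈-refl {T 0 (j - P)}) (E-prime j) ⟩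
    T 0 (j - P) + (T 0 j + T 0 (j - P - P))  ≡⟨ rotate (T 0 (j - P)) (T 0 j) (T 0 (j - P - P)) ⟩
    spread (T 0) j                           ∎
    where
    open ≈-Reasoning
    F : ℕ → ℤ
    F s = + (p C s) * E s (j - P + + s)
    pred[p]<p : ℕ.pred p ℕ.< p
    pred[p]<p = subst (ℕ.pred p ℕ.<_) (ℕ.suc-pred p) (ℕ.n<1+n (ℕ.pred p))
    inner : ∀ m → m ℕ.< p → sumToℤ m F ≈ F 0
    inner zero    _   = ≈-refl
    inner (suc m) m<p = begin
      sumToℤ m F + F (suc m)                         ≈⟨ +-cong (inner m (ℕ.<-trans (ℕ.n<1+n m) m<p))
                                                              (*-cong (∣⇒≈0 (p∣pCk (suc m) (s≤s z≤n) m<p)) ≈-refl) ⟩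
      F 0 + + 0 * E (suc m) (j - P + + suc m)        ≡⟨ ℤ.+-identityʳ (F 0) ⟩
      F 0                                            ∎
    F₀≡T₀ : F 0 ≡ T 0 (j - P)
    F₀≡T₀ = trans (ℤ.*-identityˡ _) (trans (cong (E 0) (ℤ.+-identityʳ (j - P))) (E₀≡T₀ (j - P)))
    Fₚ≡Eₚ : F p ≡ E p j
    Fₚ≡Eₚ = trans (cong (λ c → + c * E p (j - P + P)) (nCn≡1 p)) (trans (ℤ.*-identityˡ _) (cong (E p) (cancel j P)))
      where cancel : ∀ j P → j - P + P ≡ j
            cancel = solve-∀
    rotate : ∀ a b c → a + (b + c) ≡ b + a + c
    rotate = solve-∀

  spread-shift : ∀ f j k → spread f (j - k) ≡ f (j - k) + f (j - P - k) + f (j - P - P - k)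
  spread-shift f j k = cong₂ (λ x y → f (j - k) + f x + f y) (swap₁ j k P) (swap₂ j k P)
    where
    swap₁ : ∀ j k P → j - k - P ≡ j - P - k
    swap₁ = solve-∀
    swap₂ : ∀ j k P → j - k - P - P ≡ j - P - P - k
    swap₂ = solve-∀

  spread-T-suc : ∀ n j → spread (T (suc n)) j ≡ spread (T n) j + spread (T n) (j - + 1) + spread (T n) (j - + 2)
  spread-T-suc n j = begin
    spread (T (suc n)) j
      ≡⟨ regroup (T n j) (T n (j - + 1)) (T n (j - + 2)) (T n (j - P)) (T n (j - P - + 1)) (T n (j - P - + 2))
                 (T n (j - P - P)) (T n (j - P - P - + 1)) (T n (j - P - P - + 2)) ⟩
    spread (T n) j + (T n (j - + 1) + T n (j - P - + 1) + T n (j - P - P - + 1))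
                   + (T n (j - + 2) + T n (j - P - + 2) + T n (j - P - P - + 2))
      ≡⟨ sym (cong₂ (λ x y → spread (T n) j + x + y) (spread-shift (T n) j (+ 1)) (spread-shift (T n) j (+ 2))) ⟩
    spread (T n) j + spread (T n) (j - + 1) + spread (T n) (j - + 2)
      ∎
    where
    open ≡-Reasoning
    regroup : ∀ a b c d e f g h i → (a + b + c) + (d + e + f) + (g + h + i) ≡ (a + d + g) + (b + e + h) + (c + f + i)
    regroup = solve-∀

  T-+p : ∀ n j → T (n ℕ.+ p) j ≈ spread (T n) j
  T-+p zero    j = T-prime j
  T-+p (suc n) j = begin
    T (n ℕ.+ p) j + T (n ℕ.+ p) (j - + 1) + T (n ℕ.+ p) (j - + 2)
      ≈⟨ +-cong (+-cong (T-+p n j) (T-+p n (j - + 1))) (T-+p n (j - + 2)) ⟩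
    spread (T n) j + spread (T n) (j - + 1) + spread (T n) (j - + 2)
      ≡⟨ sym (spread-T-suc n j) ⟩
    spread (T (suc n)) j
      ∎
    where open ≈-Reasoning

  private
    2r<p[2+k]+e : ∀ r k e → r ℕ.< p → 2 ℕ.* r ℕ.< p ℕ.* suc (suc k) ℕ.+ e
    2r<p[2+k]+e r k e r<p = ℕ.<-≤-trans (subst (ℕ._< p ℕ.+ p) (sym (2r≡r+r r)) (ℕ.+-mono-<-≤ r<p (ℕ.<⇒≤ r<p)))
                              (subst (p ℕ.+ p ℕ.≤_) (shape p k e) (ℕ.m≤m+n (p ℕ.+ p) (p ℕ.* k ℕ.+ e)))
      where
      2r≡r+r : ∀ r → 2 ℕ.* r ≡ r ℕ.+ r
      2r≡r+r = ℕ.solve-∀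
      shape : ∀ p k e → p ℕ.+ p ℕ.+ (p ℕ.* k ℕ.+ e) ≡ p ℕ.* suc (suc k) ℕ.+ e
      shape = ℕ.solve-∀

    P*-[1+k]+e : ∀ k e → e ℕ.< p → P * -[1+ k ] + + e ≡ -[1+ (p ℕ.∸ suc e) ℕ.+ p ℕ.* k ]
    P*-[1+k]+e k e e<p = begin
      + p * - (+ 1 + + k) + + e                    ≡⟨ cong (λ m → + m * - (+ 1 + + k) + + e) (sym p≡1+e+d) ⟩
      (+ 1 + + e + + d) * - (+ 1 + + k) + + e      ≡⟨ expand (+ e) (+ d) (+ k) ⟩
      - (+ 1 + (+ d + (+ 1 + + e + + d) * + k))    ≡⟨ cong (λ m → - (+ 1 + (+ d + + m * + k))) p≡1+e+d ⟩
      - (+ 1 + (+ d + + p * + k))                  ≡⟨ cong (λ m → - (+ 1 + (+ d + m))) (sym (ℤ.pos-* p k)) ⟩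
      -[1+ d ℕ.+ p ℕ.* k ]                         ∎
      where
      open ≡-Reasoning
      d : ℕ
      d = p ℕ.∸ suc e
      p≡1+e+d : suc e ℕ.+ d ≡ p
      p≡1+e+d = ℕ.m+[n∸m]≡n e<p
      expand : ∀ e d k → (+ 1 + e + d) * - (+ 1 + k) + e ≡ - (+ 1 + (d + (+ 1 + e + d) * k))
      expand = solve-∀

  lucas-base : ∀ r q e → r ℕ.< p → e ℕ.< p →
               T r (P * q + + e) ≡ T 0 q * T r (+ e) + T 0 (q - + 1) * T r (+ e + P)
  lucas-base r (+ zero) e _ _ = trans (cong (T r) (P*0+e≡e P (+ e))) (pick₀ (T r (+ e)) (T r (+ e + P)))
    where
    P*0+e≡e : ∀ P e → P * + 0 + e ≡ e
    P*0+e≡e = solve-∀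
    pick₀ : ∀ x y → x ≡ + 1 * x + + 0 * y
    pick₀ = solve-∀
  lucas-base r (+ suc zero) e _ _ = trans (cong (T r) (P*1+e≡e+P P (+ e))) (pick₁ (T r (+ e)) (T r (+ e + P)))
    where
    P*1+e≡e+P : ∀ P e → P * + 1 + e ≡ e + P
    P*1+e≡e+P = solve-∀
    pick₁ : ∀ x y → y ≡ + 0 * x + + 1 * y
    pick₁ = solve-∀
  lucas-base r (+ suc (suc k)) e r<p _ = begin
    T r (P * + suc (suc k) + + e)        ≡⟨ cong (λ i → T r (i + + e)) (sym (ℤ.pos-* p (suc (suc k)))) ⟩
    T r (+ (p ℕ.* suc (suc k) ℕ.+ e))    ≡⟨ T-vanish r _ (2r<p[2+k]+e r k e r<p) ⟩
    + 0                                  ≡⟨ none (T r (+ e)) (T r (+ e + P)) ⟩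
    + 0 * T r (+ e) + + 0 * T r (+ e + P) ∎
    where
    open ≡-Reasoning
    none : ∀ x y → + 0 ≡ + 0 * x + + 0 * y
    none = solve-∀
  lucas-base r -[1+ k ] e _ e<p = begin
    T r (P * -[1+ k ] + + e)             ≡⟨ cong (T r) (P*-[1+k]+e k e e<p) ⟩
    T r -[1+ _ ]                         ≡⟨ T-negative r _ ⟩
    + 0                                  ≡⟨ none (T r (+ e)) (T r (+ e + P)) ⟩
    + 0 * T r (+ e) + + 0 * T r (+ e + P) ∎
    where
    open ≡-Reasoning
    none : ∀ x y → + 0 ≡ + 0 * x + + 0 * y
    none = solve-∀

  lucas : ∀ m r q e → r ℕ.< p → e ℕ.< p →
          T (m ℕ.* p ℕ.+ r) (P * q + + e) ≈ T m q * T r (+ e) + T m (q - + 1) * T r (+ e + P)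
  lucas zero    r q e r<p e<p = ≡⇒≈ (lucas-base r q e r<p e<p)
  lucas (suc m) r q e r<p e<p = begin
    T (p ℕ.+ m ℕ.* p ℕ.+ r) (P * q + + e)
      ≡⟨ cong (λ n → T n (P * q + + e)) (reorder m p r) ⟩
    T (n ℕ.+ p) (P * q + + e)
      ≈⟨ T-+p n (P * q + + e) ⟩
    spread (T n) (P * q + + e)
      ≡⟨ cong₂ (λ i j → T n (P * q + + e) + T n i + T n j) (lower₁ P q (+ e)) (lower₂ P q (+ e)) ⟩
    T n (P * q + + e) + T n (P * (q - + 1) + + e) + T n (P * (q - + 1 - + 1) + + e)
      ≈⟨ +-cong (+-cong (lucas m r q e r<p e<p) (lucas m r (q - + 1) e r<p e<p))
                (lucas m r (q - + 1 - + 1) e r<p e<p) ⟩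
    (a * R₀ + b * R₁) + (b * R₀ + c * R₁) + (c * R₀ + d * R₁)
      ≡⟨ collect a b c d R₀ R₁ ⟩
    (a + b + c) * R₀ + (b + c + d) * R₁
      ≡⟨ cong₂ (λ x y → (a + b + T m x) * R₀ + (b + c + T m y) * R₁) (sym (lower q)) (sym (lower (q - + 1))) ⟩
    T (suc m) q * R₀ + T (suc m) (q - + 1) * R₁
      ∎
    where
    open ≈-Reasoning
    n : ℕ
    n = m ℕ.* p ℕ.+ r
    a b c d R₀ R₁ : ℤ
    a = T m q
    b = T m (q - + 1)
    c = T m (q - + 1 - + 1)
    d = T m (q - + 1 - + 1 - + 1)
    R₀ = T r (+ e)
    R₁ = T r (+ e + P)
    reorder : ∀ m p r → p ℕ.+ m ℕ.* p ℕ.+ r ≡ m ℕ.* p ℕ.+ r ℕ.+ p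
    reorder = ℕ.solve-∀
    lower : ∀ q → q - + 2 ≡ q - + 1 - + 1
    lower = solve-∀
    lower₁ : ∀ P q e → P * q + e - P ≡ P * (q - + 1) + e
    lower₁ = solve-∀
    lower₂ : ∀ P q e → P * q + e - P - P ≡ P * (q - + 1 - + 1) + e
    lower₂ = solve-∀
    collect : ∀ a b c d R₀ R₁ → (a * R₀ + b * R₁) + (b * R₀ + c * R₁) + (c * R₀ + d * R₁)
                              ≡ (a + b + c) * R₀ + (b + c + d) * R₁
    collect = solve-∀

  private
    +[mp+s]≡P*m+s : ∀ m s → + (m ℕ.* p ℕ.+ s) ≡ P * + m + + s
    +[mp+s]≡P*m+s m s = trans (ℤ.pos-+ (m ℕ.* p) s) (cong (_+ + s) (trans (ℤ.pos-* m p) (ℤ.*-comm (+ m) P)))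

    d+[mp+r]≡mp+[d+r] : ∀ d m r → d ℕ.+ (m ℕ.* p ℕ.+ r) ≡ m ℕ.* p ℕ.+ (d ℕ.+ r)
    d+[mp+r]≡mp+[d+r] d m r = reassoc d m r p
      where reassoc : ∀ d m r p → d ℕ.+ (m ℕ.* p ℕ.+ r) ≡ m ℕ.* p ℕ.+ (d ℕ.+ r)
            reassoc = ℕ.solve-∀

    carry-index : ∀ m r d e → d ℕ.+ r ≡ p ℕ.+ e → + (d ℕ.+ (m ℕ.* p ℕ.+ r)) ≡ P * (+ m + + 1) + + e
    carry-index m r d e d+r≡p+e = begin
      + (d ℕ.+ (m ℕ.* p ℕ.+ r))    ≡⟨ cong +_ (d+[mp+r]≡mp+[d+r] d m r) ⟩
      + (m ℕ.* p ℕ.+ (d ℕ.+ r))    ≡⟨ cong (λ s → + (m ℕ.* p ℕ.+ s)) d+r≡p+e ⟩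
      + (m ℕ.* p ℕ.+ (p ℕ.+ e))    ≡⟨ cong +_ (sym (ℕ.+-assoc (m ℕ.* p) p e)) ⟩
      + (m ℕ.* p ℕ.+ p ℕ.+ e)      ≡⟨ cong (λ k → + (k ℕ.+ e)) (ℕ.+-comm (m ℕ.* p) p) ⟩
      + (suc m ℕ.* p ℕ.+ e)        ≡⟨ +[mp+s]≡P*m+s (suc m) e ⟩
      P * + suc m + + e            ≡⟨ cong (λ k → P * + k + + e) (ℕ.+-comm 1 m) ⟩
      P * (+ m + + 1) + + e        ∎
      where open ≡-Reasoning

  diagonal-low : ∀ m r d → r ℕ.< p → d ℕ.+ r ℕ.< p →
                 diagonal d (m ℕ.* p ℕ.+ r) ≈ diagonal 0 m * T r (+ (d ℕ.+ r))
  diagonal-low m r d r<p d+r<p = begin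
    T n (+ (d ℕ.+ n))
      ≡⟨ cong (T n) (trans (cong +_ (d+[mp+r]≡mp+[d+r] d m r)) (+[mp+s]≡P*m+s m (d ℕ.+ r))) ⟩
    T n (P * + m + + (d ℕ.+ r))
      ≈⟨ lucas m r (+ m) (d ℕ.+ r) r<p d+r<p ⟩
    T m (+ m) * T r (+ (d ℕ.+ r)) + T m (+ m - + 1) * T r (+ (d ℕ.+ r) + P)
      ≡⟨ cong (λ x → T m (+ m) * T r (+ (d ℕ.+ r)) + T m (+ m - + 1) * x) (T-vanish r _ 2r<d+r+p) ⟩
    T m (+ m) * T r (+ (d ℕ.+ r)) + T m (+ m - + 1) * + 0
      ≡⟨ drop (T m (+ m) * T r (+ (d ℕ.+ r))) (T m (+ m - + 1)) ⟩
    T m (+ m) * T r (+ (d ℕ.+ r))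
      ∎
    where
    open ≈-Reasoning
    n : ℕ
    n = m ℕ.* p ℕ.+ r
    2r<d+r+p : 2 ℕ.* r ℕ.< d ℕ.+ r ℕ.+ p
    2r<d+r+p = subst₂ ℕ._<_ (sym (2r≡r+r r)) (ℕ.+-comm p (d ℕ.+ r))
                 (ℕ.+-mono-<-≤ r<p (ℕ.m≤n+m r d))
      where 2r≡r+r : ∀ r → 2 ℕ.* r ≡ r ℕ.+ r
            2r≡r+r = ℕ.solve-∀
    drop : ∀ x y → x + y * + 0 ≡ x
    drop = solve-∀

  diagonal-carry : ∀ m r d e → r ℕ.< p → e ℕ.< p → d ℕ.+ r ≡ p ℕ.+ e →
                   diagonal d (m ℕ.* p ℕ.+ r) ≈ diagonal 1 m * T r (+ e) + diagonal 0 m * T r (+ (p ℕ.+ e))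
  diagonal-carry m r d e r<p e<p d+r≡p+e = begin
    T n (+ (d ℕ.+ n))
      ≡⟨ cong (T n) (carry-index m r d e d+r≡p+e) ⟩
    T n (P * (+ m + + 1) + + e)
      ≈⟨ lucas m r (+ m + + 1) e r<p e<p ⟩
    T m (+ m + + 1) * T r (+ e) + T m (+ m + + 1 - + 1) * T r (+ e + P)
      ≡⟨ cong₂ (λ i j → T m i * T r (+ e) + T m j * T r (+ e + P)) (cong +_ (ℕ.+-comm m 1)) (m+1-1≡m (+ m)) ⟩
    T m (+ suc m) * T r (+ e) + T m (+ m) * T r (+ e + P)
      ≡⟨ cong (λ i → T m (+ suc m) * T r (+ e) + T m (+ m) * T r (+ i)) (ℕ.+-comm e p) ⟩
    T m (+ suc m) * T r (+ e) + T m (+ m) * T r (+ (p ℕ.+ e))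
      ∎
    where
    open ≈-Reasoning
    n : ℕ
    n = m ℕ.* p ℕ.+ r
    m+1-1≡m : ∀ m → m + + 1 - + 1 ≡ m
    m+1-1≡m = solve-∀

  spread-Ψ-suc : ∀ k j →
                 spread (Ψ (suc k)) j ≡ spread (Ψ (suc k)) (j - + 3) + (spread (Ψ k) j - spread (Ψ k) (j - + 1))
  spread-Ψ-suc k j = begin
    spread (Ψ (suc k)) j
      ≡⟨ cong₂ _+_ (cong₂ _+_ (Ψ-suc k j) (Ψ-suc k (j - P))) (Ψ-suc k (j - P - P)) ⟩
    (Ψ′ (j - + 3) + (Ψ k j - Ψ k (j - + 1)))
      + (Ψ′ (j - P - + 3) + (Ψ k (j - P) - Ψ k (j - P - + 1)))
      + (Ψ′ (j - P - P - + 3) + (Ψ k (j - P - P) - Ψ k (j - P - P - + 1)))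
      ≡⟨ regroup (Ψ′ (j - + 3)) (Ψ′ (j - P - + 3)) (Ψ′ (j - P - P - + 3)) (Ψ k j) (Ψ k (j - P)) (Ψ k (j - P - P))
                 (Ψ k (j - + 1)) (Ψ k (j - P - + 1)) (Ψ k (j - P - P - + 1)) ⟩
    (Ψ′ (j - + 3) + Ψ′ (j - P - + 3) + Ψ′ (j - P - P - + 3))
      + (spread (Ψ k) j - (Ψ k (j - + 1) + Ψ k (j - P - + 1) + Ψ k (j - P - P - + 1)))
      ≡⟨ sym (cong₂ (λ x y → x + (spread (Ψ k) j - y)) (spread-shift Ψ′ j (+ 3))
                                                         (spread-shift (Ψ k) j (+ 1))) ⟩
    spread Ψ′ (j - + 3) + (spread (Ψ k) j - spread (Ψ k) (j - + 1))
      ∎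
    where
    open ≡-Reasoning
    Ψ′ : ℤ → ℤ
    Ψ′ = Ψ (suc k)
    regroup : ∀ a b c d e f g h i →
              (a + (d - g)) + (b + (e - h)) + (c + (f - i)) ≡ (a + b + c) + ((d + e + f) - (g + h + i))
    regroup = solve-∀

  spread-Ψ-negative : ∀ k m → spread (Ψ k) -[1+ m ] ≡ + 0
  spread-Ψ-negative k m rewrite ℤ.neg-minus-pos m p | ℤ.neg-minus-pos (p ℕ.+ m) p = refl

  T-complement : ∀ k n → n ℕ.+ k ≡ p → ∀ j → T n j ≈ spread (Ψ k) j
  T-complement zero n n+0≡p j = begin
    T n j           ≡⟨ cong (λ m → T m j) (trans (sym (ℕ.+-identityʳ n)) n+0≡p) ⟩
    T p j           ≈⟨ T-prime j ⟩
    spread (T 0) j  ≡⟨ sym (cong₂ _+_ (cong₂ _+_ (Ψ₀≡T₀ j) (Ψ₀≡T₀ (j - P))) (Ψ₀≡T₀ (j - P - P))) ⟩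
    spread (Ψ 0) j  ∎
    where open ≈-Reasoning
  T-complement (suc k) n n+1+k≡p = row
    where
    next : ∀ j → T (suc n) j ≈ spread (Ψ k) j
    next = T-complement k (suc n) (trans (sym (ℕ.+-suc n k)) n+1+k≡p)
    row : ∀ j → T n j ≈ spread (Ψ (suc k)) j
    below : ∀ i → T n (+ i - + 3) ≈ spread (Ψ (suc k)) (+ i - + 3)
    row -[1+ m ] = ≡⇒≈ (trans (T-negative n m) (sym (spread-Ψ-negative (suc k) m)))
    row (+ i) = begin
      T n (+ i)
        ≡⟨ T-diff n (+ i) ⟩
      T n (+ i - + 3) + (T (suc n) (+ i) - T (suc n) (+ i - + 1))
        ≈⟨ +-cong (below i) (-cong (next (+ i)) (next (+ i - + 1))) ⟩
      spread (Ψ (suc k)) (+ i - + 3) + (spread (Ψ k) (+ i) - spread (Ψ k) (+ i - + 1))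
        ≡⟨ sym (spread-Ψ-suc k (+ i)) ⟩
      spread (Ψ (suc k)) (+ i)
        ∎
      where open ≈-Reasoning
    below 0                   = row -[1+ 2 ]
    below 1                   = row -[1+ 1 ]
    below 2                   = row -[1+ 0 ]
    below (suc (suc (suc i))) = row (+ i)

  private
    +i-P-negative : ∀ i → i ℕ.< p → + i - P ≡ -[1+ (p ℕ.∸ suc i) ℕ.+ p ℕ.* 0 ]
    +i-P-negative i i<p = trans (rewrite-as (+ i) P) (P*-[1+k]+e 0 i i<p)
      where rewrite-as : ∀ x P → x - P ≡ P * - + 1 + x
            rewrite-as = solve-∀

  spread-Ψ-low : ∀ k i → i ℕ.< p → spread (Ψ k) (+ i) ≡ ψ k i
  spread-Ψ-low k i i<p rewrite +i-P-negative i i<p | ℤ.neg-minus-pos ((p ℕ.∸ suc i) ℕ.+ p ℕ.* 0) p =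
    trans (ℤ.+-identityʳ _) (ℤ.+-identityʳ _)

  spread-Ψ-high : ∀ k i → i ℕ.< p → spread (Ψ k) (+ (p ℕ.+ i)) ≡ ψ k (p ℕ.+ i) + ψ k i
  spread-Ψ-high k i i<p = begin
    ψ k (p ℕ.+ i) + Ψ k (+ (p ℕ.+ i) - P) + Ψ k (+ (p ℕ.+ i) - P - P)
      ≡⟨ cong (λ x → ψ k (p ℕ.+ i) + Ψ k x + Ψ k (x - P)) p+i-P≡i ⟩
    ψ k (p ℕ.+ i) + ψ k i + Ψ k (+ i - P)
      ≡⟨ cong (λ x → ψ k (p ℕ.+ i) + ψ k i + Ψ k x) (+i-P-negative i i<p) ⟩
    ψ k (p ℕ.+ i) + ψ k i + + 0
      ≡⟨ ℤ.+-identityʳ _ ⟩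
    ψ k (p ℕ.+ i) + ψ k i
      ∎
    where
    open ≡-Reasoning
    p+i-P≡i : + (p ℕ.+ i) - P ≡ + i
    p+i-P≡i = trans (cong (_- P) (ℤ.pos-+ p i)) (cancel P (+ i))
      where cancel : ∀ P i → P + i - P ≡ i
            cancel = solve-∀

  -- withTrailing j m is m followed by j base-p digits p − 1, that is (m + 1)·pʲ − 1.
  withTrailing : ℕ → ℕ → ℕ
  withTrailing zero    m = m
  withTrailing (suc j) m = withTrailing j m ℕ.* p ℕ.+ ℕ.pred p

  T-complement-low : ∀ k n i → n ℕ.+ k ≡ p → i ℕ.< p → T n (+ i) ≈ ψ k i
  T-complement-low k n i n+k≡p i<p = ≈-trans (T-complement k n n+k≡p (+ i)) (≡⇒≈ (spread-Ψ-low k i i<p))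

  T-complement-high : ∀ k n i → n ℕ.+ k ≡ p → i ℕ.< p → T n (+ (p ℕ.+ i)) ≈ ψ k (p ℕ.+ i) + ψ k i
  T-complement-high k n i n+k≡p i<p =
    ≈-trans (T-complement k n n+k≡p (+ (p ℕ.+ i))) (≡⇒≈ (spread-Ψ-high k i i<p))

  private
    x*p+pred[p]+1≡x*p+p : ∀ x → x ℕ.* p ℕ.+ ℕ.pred p ℕ.+ 1 ≡ x ℕ.* p ℕ.+ p
    x*p+pred[p]+1≡x*p+p x = trans (ℕ.+-assoc (x ℕ.* p) (ℕ.pred p) 1)
                                  (cong (x ℕ.* p ℕ.+_) (trans (ℕ.+-comm (ℕ.pred p) 1) (ℕ.suc-pred p)))

  withTrailing+1 : ∀ j m → withTrailing j m ℕ.+ 1 ≡ (m ℕ.+ 1) ℕ.* p ℕ.^ j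
  withTrailing+1 zero    m = sym (ℕ.*-identityʳ (m ℕ.+ 1))
  withTrailing+1 (suc j) m = begin
    F ℕ.* p ℕ.+ ℕ.pred p ℕ.+ 1   ≡⟨ x*p+pred[p]+1≡x*p+p F ⟩
    F ℕ.* p ℕ.+ p                ≡⟨ factor F p ⟩
    (F ℕ.+ 1) ℕ.* p              ≡⟨ cong (ℕ._* p) (withTrailing+1 j m) ⟩
    (m ℕ.+ 1) ℕ.* p ℕ.^ j ℕ.* p  ≡⟨ reassoc (m ℕ.+ 1) (p ℕ.^ j) p ⟩
    (m ℕ.+ 1) ℕ.* p ℕ.^ suc j    ∎
    where
    open ≡-Reasoning
    F : ℕ
    F = withTrailing j m
    factor : ∀ F p → F ℕ.* p ℕ.+ p ≡ (F ℕ.+ 1) ℕ.* p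
    factor = ℕ.solve-∀
    reassoc : ∀ a b p → a ℕ.* b ℕ.* p ≡ a ℕ.* (p ℕ.* b)
    reassoc = ℕ.solve-∀

  withTrailing-decode : ∀ n j m d → d ℕ.< p → n ℕ.+ suc d ≡ (m ℕ.+ 1) ℕ.* p ℕ.^ suc j →
                        n ≡ withTrailing j m ℕ.* p ℕ.+ (p ℕ.∸ suc d)
  withTrailing-decode n j m d d<p eq = ℕ.+-cancelʳ-≡ (suc d) n _ (begin
    n ℕ.+ suc d                                     ≡⟨ eq ⟩
    (m ℕ.+ 1) ℕ.* p ℕ.^ suc j                       ≡⟨ sym (withTrailing+1 (suc j) m) ⟩
    F ℕ.* p ℕ.+ ℕ.pred p ℕ.+ 1                      ≡⟨ x*p+pred[p]+1≡x*p+p F ⟩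
    F ℕ.* p ℕ.+ p                                   ≡⟨ cong (F ℕ.* p ℕ.+_) (sym (ℕ.m∸n+n≡m d<p)) ⟩
    F ℕ.* p ℕ.+ (p ℕ.∸ suc d ℕ.+ suc d)             ≡⟨ sym (ℕ.+-assoc (F ℕ.* p) (p ℕ.∸ suc d) (suc d)) ⟩
    F ℕ.* p ℕ.+ (p ℕ.∸ suc d) ℕ.+ suc d             ∎)
    where
    open ≡-Reasoning
    F : ℕ
    F = withTrailing j m

module Prime≡5mod6 (a : ℕ) (p-prime : Prime (5 ℕ.+ 6 ℕ.* a)) where
  open import Data.Integer.Base using (_+_; _-_; _*_; -_)
  open Trinomials
  open Congruence (5 ℕ.+ 6 ℕ.* a)
  open TrinomialsModPrime (5 ℕ.+ 6 ℕ.* a) p-prime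

  p p-1 p-2 p-3 : ℕ
  p   = 5 ℕ.+ 6 ℕ.* a
  p-1 = 4 ℕ.+ 6 ℕ.* a
  p-2 = 3 ℕ.+ 6 ℕ.* a
  p-3 = 2 ℕ.+ 6 ℕ.* a

  private
    p-1≡3[1+2a]+1 : p-1 ≡ 3 ℕ.* (1 ℕ.+ 2 ℕ.* a) ℕ.+ 1
    p-1≡3[1+2a]+1 = shape a
      where shape : ∀ a → 4 ℕ.+ 6 ℕ.* a ≡ 3 ℕ.* (1 ℕ.+ 2 ℕ.* a) ℕ.+ 1
            shape = ℕ.solve-∀
    p-2≡3[1+2a]+0 : p-2 ≡ 3 ℕ.* (1 ℕ.+ 2 ℕ.* a) ℕ.+ 0
    p-2≡3[1+2a]+0 = shape a
      where shape : ∀ a → 3 ℕ.+ 6 ℕ.* a ≡ 3 ℕ.* (1 ℕ.+ 2 ℕ.* a) ℕ.+ 0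
            shape = ℕ.solve-∀
    p-3≡3[2a]+2 : p-3 ≡ 3 ℕ.* (2 ℕ.* a) ℕ.+ 2
    p-3≡3[2a]+2 = shape a
      where shape : ∀ a → 2 ℕ.+ 6 ℕ.* a ≡ 3 ℕ.* (2 ℕ.* a) ℕ.+ 2
            shape = ℕ.solve-∀
    p≡3[1+2a]+2 : p ≡ 3 ℕ.* (1 ℕ.+ 2 ℕ.* a) ℕ.+ 2
    p≡3[1+2a]+2 = shape a
      where shape : ∀ a → 5 ℕ.+ 6 ℕ.* a ≡ 3 ℕ.* (1 ℕ.+ 2 ℕ.* a) ℕ.+ 2
            shape = ℕ.solve-∀
    p+1≡3[2+2a]+0 : p ℕ.+ 1 ≡ 3 ℕ.* (2 ℕ.+ 2 ℕ.* a) ℕ.+ 0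
    p+1≡3[2+2a]+0 = shape a
      where shape : ∀ a → 5 ℕ.+ 6 ℕ.* a ℕ.+ 1 ≡ 3 ℕ.* (2 ℕ.+ 2 ℕ.* a) ℕ.+ 0
            shape = ℕ.solve-∀

  private
    p-1<p : p-1 ℕ.< p
    p-1<p = ℕ.n<1+n p-1
    p-2<p : p-2 ℕ.< p
    p-2<p = ℕ.<-trans (ℕ.n<1+n p-2) p-1<p
    p-3<p : p-3 ℕ.< p
    p-3<p = ℕ.<-trans (ℕ.n<1+n p-3) p-2<p
    0<p : 0 ℕ.< p
    0<p = s≤s z≤n
    1<p : 1 ℕ.< p
    1<p = s≤s (s≤s z≤n)
    2<p : 2 ℕ.< p
    2<p = s≤s (s≤s (s≤s z≤n))

    p-1+1≡p : p-1 ℕ.+ 1 ≡ p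
    p-1+1≡p = ℕ.+-comm p-1 1
    p-2+2≡p : p-2 ℕ.+ 2 ≡ p
    p-2+2≡p = ℕ.+-comm p-2 2
    p-3+3≡p : p-3 ℕ.+ 3 ≡ p
    p-3+3≡p = ℕ.+-comm p-3 3

  T[p-1,1] : T p-1 (+ 1) ≈ - + 1
  T[p-1,1] = T-complement-low 1 p-1 1 p-1+1≡p 1<p

  T[p-1,p-1] : T p-1 (+ p-1) ≈ - + 1
  T[p-1,p-1] = ≈-trans (T-complement-low 1 p-1 p-1 p-1+1≡p p-1<p)
                       (≡⇒≈ (trans (cong (ψ 1) p-1≡3[1+2a]+1) (ψ₁-periodic (1 ℕ.+ 2 ℕ.* a) 1)))

  T[p-1,p] : T p-1 (+ (p ℕ.+ 0)) ≈ + 1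
  T[p-1,p] = ≈-trans (T-complement-high 1 p-1 0 p-1+1≡p 0<p)
                     (≡⇒≈ (cong (_+ + 1) (trans (cong (ψ 1) (trans (ℕ.+-identityʳ p) p≡3[1+2a]+2))
                                                       (ψ₁-periodic (1 ℕ.+ 2 ℕ.* a) 2))))

  T[p-1,p+1] : T p-1 (+ (p ℕ.+ 1)) ≈ + 0
  T[p-1,p+1] = ≈-trans (T-complement-high 1 p-1 1 p-1+1≡p 1<p)
                       (≡⇒≈ (cong (_+ - + 1) (trans (cong (ψ 1) p+1≡3[2+2a]+0) (ψ₁-periodic (2 ℕ.+ 2 ℕ.* a) 0))))

  T[p-2,p-2]-T[p-2,p] : T p-2 (+ p-2) - T p-2 (+ (p ℕ.+ 0)) ≈ - + 1
  T[p-2,p-2]-T[p-2,p] = begin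
    T p-2 (+ p-2) - T p-2 (+ (p ℕ.+ 0))
      ≈⟨ -cong (T-complement-low 2 p-2 p-2 p-2+2≡p p-2<p) (T-complement-high 2 p-2 0 p-2+2≡p 0<p) ⟩
    ψ 2 p-2 - (ψ 2 (p ℕ.+ 0) + + 1)
      ≡⟨ cong₂ (λ i j → ψ 2 i - (ψ 2 j + + 1)) p-2≡3[1+2a]+0 (trans (ℕ.+-identityʳ p) p≡3[1+2a]+2) ⟩
    ψ 2 (3 ℕ.* m ℕ.+ 0) - (ψ 2 (3 ℕ.* m ℕ.+ 2) + + 1)
      ≡⟨ cong₂ (λ x y → x - (y + + 1)) (ψ₂-linear m 0) (ψ₂-linear m 2) ⟩
    (+ 1 + + m * (+ 1 - + 0)) - ((+ 1 + + m * (+ 0 - - + 1)) + + 1)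
      ≡⟨ simplify (+ m) ⟩
    - + 1
      ∎
    where
    open ≈-Reasoning
    m : ℕ
    m = 1 ℕ.+ 2 ℕ.* a
    simplify : ∀ m → (+ 1 + m * (+ 1 - + 0)) - ((+ 1 + m * (+ 0 - - + 1)) + + 1) ≡ - + 1
    simplify = solve-∀

  2T[p-2,p-2]+T[p-2,p-1] : + 2 * T p-2 (+ p-2) + T p-2 (+ p-1) ≈ + 0
  2T[p-2,p-2]+T[p-2,p-1] = begin
    + 2 * T p-2 (+ p-2) + T p-2 (+ p-1)
      ≈⟨ +-cong (*-congˡ (+ 2) (T-complement-low 2 p-2 p-2 p-2+2≡p p-2<p)) (T-complement-low 2 p-2 p-1 p-2+2≡p p-1<p) ⟩
    + 2 * ψ 2 p-2 + ψ 2 p-1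
      ≡⟨ cong₂ (λ i j → + 2 * ψ 2 i + ψ 2 j) p-2≡3[1+2a]+0 p-1≡3[1+2a]+1 ⟩
    + 2 * ψ 2 (3 ℕ.* m ℕ.+ 0) + ψ 2 (3 ℕ.* m ℕ.+ 1)
      ≡⟨ cong₂ (λ x y → + 2 * x + y) (ψ₂-linear m 0) (ψ₂-linear m 1) ⟩
    + 2 * (+ 1 + + m * (+ 1 - + 0)) + (- + 2 + + m * (- + 1 - + 1))
      ≡⟨ simplify (+ m) ⟩
    + 0
      ∎
    where
    open ≈-Reasoning
    m : ℕ
    m = 1 ℕ.+ 2 ℕ.* a
    simplify : ∀ m → + 2 * (+ 1 + m * (+ 1 - + 0)) + (- + 2 + m * (- + 1 - + 1)) ≡ + 0
    simplify = solve-∀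

  private
    2ψ₃[p-3] : + 2 * ψ 3 p-3 ≡ + 2 * (+ 3 * ((+ 1 + + 2 * + a) * (+ 1 + + a)))
    2ψ₃[p-3] = begin
      + 2 * ψ 3 p-3                                     ≡⟨ cong (λ i → + 2 * ψ 3 i) p-3≡3[2a]+2 ⟩
      + 2 * ψ 3 (3 ℕ.* (2 ℕ.* a) ℕ.+ 2)                 ≡⟨ ψ₃-residue₂ (2 ℕ.* a) ⟩
      + 3 * ((+ 1 + + (2 ℕ.* a)) * (+ 2 + + (2 ℕ.* a))) ≡⟨ cong (λ x → + 3 * ((+ 1 + x) * (+ 2 + x))) (ℤ.pos-* 2 a) ⟩
      + 3 * ((+ 1 + + 2 * + a) * (+ 2 + + 2 * + a))     ≡⟨ halve (+ a) ⟩
      + 2 * (+ 3 * ((+ 1 + + 2 * + a) * (+ 1 + + a)))   ∎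
      where
      open ≡-Reasoning
      halve : ∀ a → + 3 * ((+ 1 + + 2 * a) * (+ 2 + + 2 * a)) ≡ + 2 * (+ 3 * ((+ 1 + + 2 * a) * (+ 1 + a)))
      halve = solve-∀

  T[p-3,p-3]+T[p-3,p-2] : T p-3 (+ p-3) + T p-3 (+ p-2) ≈ + 0
  T[p-3,p-3]+T[p-3,p-2] = begin
    T p-3 (+ p-3) + T p-3 (+ p-2)
      ≈⟨ +-cong (T-complement-low 3 p-3 p-3 p-3+3≡p p-3<p) (T-complement-low 3 p-3 p-2 p-3+3≡p p-2<p) ⟩
    ψ 3 p-3 + ψ 3 p-2
      ≡⟨ cong₂ _+_ (ℤ.*-cancelˡ-≡ (+ 2) _ _ 2ψ₃[p-3]) (trans (cong (ψ 3) p-2≡3[1+2a]+0) (ψ₃-residue₀ (1 ℕ.+ 2 ℕ.* a))) ⟩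
    + 3 * ((+ 1 + + 2 * + a) * (+ 1 + + a)) + (+ 2 + + (2 ℕ.* a))
      ≡⟨ cong (λ x → + 3 * ((+ 1 + + 2 * + a) * (+ 1 + + a)) + (+ 2 + x)) (ℤ.pos-* 2 a) ⟩
    + 3 * ((+ 1 + + 2 * + a) * (+ 1 + + a)) + (+ 2 + + 2 * + a)
      ≡⟨ factor (+ a) ⟩
    (+ 1 + + a) * (+ 5 + + 6 * + a)
      ≡⟨ cong (λ x → (+ 1 + + a) * (+ 5 + x)) (sym (ℤ.pos-* 6 a)) ⟩
    (+ 1 + + a) * P
      ≈⟨ m*P≈0 (+ 1 + + a) ⟩
    + 0
      ∎
    where
    open ≈-Reasoning
    factor : ∀ a → + 3 * ((+ 1 + + 2 * a) * (+ 1 + a)) + (+ 2 + + 2 * a) ≡ (+ 1 + a) * (+ 5 + + 6 * a)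
    factor = solve-∀

  A B D : ℕ → ℤ
  A = diagonal 0
  B = diagonal 1
  D = diagonal 2

  A-first-digit : ∀ i r → r ℕ.< p → A (i ℕ.* p ℕ.+ r) ≈ A i * T r (+ r)
  A-first-digit i r r<p = diagonal-low i r 0 r<p r<p

  B-first-digit : ∀ i r → suc r ℕ.< p → B (i ℕ.* p ℕ.+ r) ≈ A i * T r (+ suc r)
  B-first-digit i r 1+r<p = diagonal-low i r 1 (ℕ.<-trans (ℕ.n<1+n r) 1+r<p) 1+r<p

  A-digit-p-1 : ∀ m → A (m ℕ.* p ℕ.+ p-1) ≈ - A m
  A-digit-p-1 m = begin
    A (m ℕ.* p ℕ.+ p-1)  ≈⟨ A-first-digit m p-1 p-1<p ⟩
    A m * T p-1 (+ p-1)  ≈⟨ *-congˡ (A m) T[p-1,p-1] ⟩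
    A m * - + 1          ≡⟨ ℤ.*-comm (A m) (- + 1) ⟩
    - + 1 * A m          ≡⟨ ℤ.-1*i≡-i (A m) ⟩
    - A m                ∎
    where open ≈-Reasoning

  B-digit-p-1 : ∀ m → B (m ℕ.* p ℕ.+ p-1) ≈ B m + A m
  B-digit-p-1 m = begin
    B (m ℕ.* p ℕ.+ p-1)
      ≈⟨ diagonal-carry m p-1 1 0 p-1<p 0<p (sym (ℕ.+-identityʳ p)) ⟩
    B m * T p-1 (+ 0) + A m * T p-1 (+ (p ℕ.+ 0))
      ≈⟨ +-cong (≡⇒≈ (cong (B m *_) (T-zero p-1))) (*-congˡ (A m) T[p-1,p]) ⟩
    B m * + 1 + A m * + 1
      ≡⟨ cong₂ _+_ (ℤ.*-identityʳ (B m)) (ℤ.*-identityʳ (A m)) ⟩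
    B m + A m
      ∎
    where open ≈-Reasoning

  D-digit-p-1 : ∀ m → D (m ℕ.* p ℕ.+ p-1) ≈ - B m
  D-digit-p-1 m = begin
    D (m ℕ.* p ℕ.+ p-1)
      ≈⟨ diagonal-carry m p-1 2 1 p-1<p 1<p (ℕ.+-comm 1 p) ⟩
    B m * T p-1 (+ 1) + A m * T p-1 (+ (p ℕ.+ 1))
      ≈⟨ +-cong (*-congˡ (B m) T[p-1,1]) (*-congˡ (A m) T[p-1,p+1]) ⟩
    B m * - + 1 + A m * + 0
      ≡⟨ simplify (A m) (B m) ⟩
    - B m
      ∎
    where
    open ≈-Reasoning
    simplify : ∀ a b → b * - + 1 + a * + 0 ≡ - b
    simplify = solve-∀

  D-digit-p-2 : ∀ m → D (m ℕ.* p ℕ.+ p-2) ≈ B m + A m * T p-2 (+ (p ℕ.+ 0))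
  D-digit-p-2 m = begin
    D (m ℕ.* p ℕ.+ p-2)
      ≈⟨ diagonal-carry m p-2 2 0 p-2<p 0<p (sym (ℕ.+-identityʳ p)) ⟩
    B m * T p-2 (+ 0) + A m * T p-2 (+ (p ℕ.+ 0))
      ≡⟨ cong (λ x → B m * x + A m * T p-2 (+ (p ℕ.+ 0))) (T-zero p-2) ⟩
    B m * + 1 + A m * T p-2 (+ (p ℕ.+ 0))
      ≡⟨ cong (_+ A m * T p-2 (+ (p ℕ.+ 0))) (ℤ.*-identityʳ (B m)) ⟩
    B m + A m * T p-2 (+ (p ℕ.+ 0))
      ∎
    where open ≈-Reasoning

  motzkin-last-digit-p-1 : ∀ m → + motzkin (m ℕ.* p ℕ.+ p-1) ≈ B m - A m
  motzkin-last-digit-p-1 m = begin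
    + motzkin n    ≡⟨ motzkin≡diagonal₀-diagonal₂ n ⟩
    A n - D n      ≈⟨ -cong (A-digit-p-1 m) (D-digit-p-1 m) ⟩
    - A m - - B m  ≡⟨ swap (A m) (B m) ⟩
    B m - A m      ∎
    where
    open ≈-Reasoning
    n : ℕ
    n = m ℕ.* p ℕ.+ p-1
    swap : ∀ a b → - a - - b ≡ b - a
    swap = solve-∀

  motzkin-last-digit-p-2 : ∀ m → + motzkin (m ℕ.* p ℕ.+ p-2) ≈ - (A m + B m)
  motzkin-last-digit-p-2 m = begin
    + motzkin n
      ≡⟨ motzkin≡diagonal₀-diagonal₂ n ⟩
    A n - D n
      ≈⟨ -cong (A-first-digit m p-2 p-2<p) (D-digit-p-2 m) ⟩
    A m * T p-2 (+ p-2) - (B m + A m * T p-2 (+ (p ℕ.+ 0)))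
      ≡⟨ collect (A m) (B m) (T p-2 (+ p-2)) (T p-2 (+ (p ℕ.+ 0))) ⟩
    A m * (T p-2 (+ p-2) - T p-2 (+ (p ℕ.+ 0))) - B m
      ≈⟨ -cong (*-congˡ (A m) T[p-2,p-2]-T[p-2,p]) (≈-refl {B m}) ⟩
    A m * - + 1 - B m
      ≡⟨ simplify (A m) (B m) ⟩
    - (A m + B m)
      ∎
    where
    open ≈-Reasoning
    n : ℕ
    n = m ℕ.* p ℕ.+ p-2
    collect : ∀ a b x y → a * x - (b + a * y) ≡ a * (x - y) - b
    collect = solve-∀
    simplify : ∀ a b → a * - + 1 - b ≡ - (a + b)
    simplify = solve-∀

  A-trailing-even : ∀ k m → A (withTrailing (2 ℕ.* k) m) ≈ A m
  A-trailing-odd  : ∀ k m → A (withTrailing (suc (2 ℕ.* k)) m) ≈ - A m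
  A-trailing-even zero    m = ≈-refl
  A-trailing-even (suc k) m = subst (λ j → A (withTrailing j m) ≈ A m) (sym (2[1+k]≡2+2k k)) (begin
    A (withTrailing (suc (2 ℕ.* k)) m ℕ.* p ℕ.+ p-1)  ≈⟨ A-digit-p-1 (withTrailing (suc (2 ℕ.* k)) m) ⟩
    - A (withTrailing (suc (2 ℕ.* k)) m)            ≈⟨ -‿cong (A-trailing-odd k m) ⟩
    - - A m                                         ≡⟨ ℤ.neg-involutive (A m) ⟩
    A m                                             ∎)
    where open ≈-Reasoning
  A-trailing-odd k m = ≈-trans (A-digit-p-1 (withTrailing (2 ℕ.* k) m)) (-‿cong (A-trailing-even k m))

  B-trailing-even : ∀ k m → B (withTrailing (2 ℕ.* k) m) ≈ B m
  B-trailing-odd  : ∀ k m → B (withTrailing (suc (2 ℕ.* k)) m) ≈ B m + A m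
  B-trailing-even zero    m = ≈-refl
  B-trailing-even (suc k) m = subst (λ j → B (withTrailing j m) ≈ B m) (sym (2[1+k]≡2+2k k)) (begin
    B (withTrailing (suc (2 ℕ.* k)) m ℕ.* p ℕ.+ p-1)   ≈⟨ B-digit-p-1 (withTrailing (suc (2 ℕ.* k)) m) ⟩
    B (withTrailing (suc (2 ℕ.* k)) m)
      + A (withTrailing (suc (2 ℕ.* k)) m)           ≈⟨ +-cong (B-trailing-odd k m) (A-trailing-odd k m) ⟩
    B m + A m + - A m                                ≡⟨ cancel (B m) (A m) ⟩
    B m                                              ∎)
    where
    open ≈-Reasoning
    cancel : ∀ b a → b + a + - a ≡ b
    cancel = solve-∀
  B-trailing-odd k m =
    ≈-trans (B-digit-p-1 (withTrailing (2 ℕ.* k) m)) (+-cong (B-trailing-even k m) (A-trailing-even k m))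

  private
    decode : ∀ {n m′ e} d m j → d ℕ.< p → n ℕ.+ suc d ≡ m′ ℕ.* p ℕ.^ e → m′ ≡ m ℕ.+ 1 → e ≡ suc j →
             n ≡ withTrailing j m ℕ.* p ℕ.+ (p ℕ.∸ suc d)
    decode {n} d m j d<p eq refl refl = withTrailing-decode n j m d d<p eq

    2k+1≡1+2k : ∀ k → 2 ℕ.* k ℕ.+ 1 ≡ suc (2 ℕ.* k)
    2k+1≡1+2k k = ℕ.+-comm (2 ℕ.* k) 1

    p*i+[1+r]≡i*p+r+1 : ∀ i r → p ℕ.* i ℕ.+ suc r ≡ i ℕ.* p ℕ.+ r ℕ.+ 1
    p*i+[1+r]≡i*p+r+1 i r = shape p i r
      where shape : ∀ p i r → p ℕ.* i ℕ.+ suc r ≡ i ℕ.* p ℕ.+ r ℕ.+ 1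
            shape = ℕ.solve-∀

    p*i+p∸d≡i*p+r+1 : ∀ i r d → r ℕ.+ suc d ≡ p → p ℕ.* i ℕ.+ p ℕ.∸ d ≡ i ℕ.* p ℕ.+ r ℕ.+ 1
    p*i+p∸d≡i*p+r+1 i r d r+1+d≡p = begin
      p ℕ.* i ℕ.+ p ℕ.∸ d                     ≡⟨ cong (λ x → p ℕ.* i ℕ.+ x ℕ.∸ d) (sym r+1+d≡p) ⟩
      p ℕ.* i ℕ.+ (r ℕ.+ suc d) ℕ.∸ d         ≡⟨ cong (ℕ._∸ d) (shape p i r d) ⟩
      i ℕ.* p ℕ.+ r ℕ.+ 1 ℕ.+ d ℕ.∸ d         ≡⟨ ℕ.m+n∸n≡m (i ℕ.* p ℕ.+ r ℕ.+ 1) d ⟩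
      i ℕ.* p ℕ.+ r ℕ.+ 1                     ∎
      where
      open ≡-Reasoning
      shape : ∀ p i r d → p ℕ.* i ℕ.+ (r ℕ.+ suc d) ≡ i ℕ.* p ℕ.+ r ℕ.+ 1 ℕ.+ d
      shape = ℕ.solve-∀

  motzkin≈0-i : ∀ {n} → ∃[ i ] ∃[ k ] (k ℕ.≥ 1 × n ℕ.+ 2 ≡ (p ℕ.* i ℕ.+ 1) ℕ.* p ℕ.^ (2 ℕ.* k)) →
                + motzkin n ≈ + 0
  motzkin≈0-i {n} (i , suc k , _ , eq) = begin
    + motzkin n
      ≡⟨ cong (+_ ∘ motzkin) (decode 1 m₀ (suc (2 ℕ.* k)) 1<p eq (p*i+[1+r]≡i*p+r+1 i 0) (2[1+k]≡2+2k k)) ⟩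
    + motzkin (x ℕ.* p ℕ.+ p-2)
      ≈⟨ motzkin-last-digit-p-2 x ⟩
    - (A x + B x)
      ≈⟨ -‿cong (+-cong (A-trailing-odd k m₀) (B-trailing-odd k m₀)) ⟩
    - (- A m₀ + (B m₀ + A m₀))
      ≡⟨ cancel (A m₀) (B m₀) ⟩
    - B m₀
      ≈⟨ -‿cong (B-first-digit i 0 1<p) ⟩
    - (A i * + 0)
      ≡⟨ cong -_ (ℤ.*-zeroʳ (A i)) ⟩
    + 0
      ∎
    where
    open ≈-Reasoning
    m₀ x : ℕ
    m₀ = i ℕ.* p ℕ.+ 0
    x  = withTrailing (suc (2 ℕ.* k)) m₀
    cancel : ∀ a b → - (- a + (b + a)) ≡ - b
    cancel = solve-∀

  motzkin≈0-ii : ∀ {n} → ∃[ i ] ∃[ k ] (n ℕ.+ 2 ≡ (p ℕ.* i ℕ.+ p ℕ.∸ 2) ℕ.* p ℕ.^ (2 ℕ.* k ℕ.+ 1)) →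
                 + motzkin n ≈ + 0
  motzkin≈0-ii {n} (i , k , eq) = begin
    + motzkin n
      ≡⟨ cong (+_ ∘ motzkin) (decode 1 m₀ (2 ℕ.* k) 1<p eq (p*i+p∸d≡i*p+r+1 i p-3 2 (ℕ.+-comm p-3 3)) (2k+1≡1+2k k)) ⟩
    + motzkin (x ℕ.* p ℕ.+ p-2)
      ≈⟨ motzkin-last-digit-p-2 x ⟩
    - (A x + B x)
      ≈⟨ -‿cong (+-cong (A-trailing-even k m₀) (B-trailing-even k m₀)) ⟩
    - (A m₀ + B m₀)
      ≈⟨ -‿cong (+-cong (A-first-digit i p-3 p-3<p) (B-first-digit i p-3 p-2<p)) ⟩
    - (A i * T p-3 (+ p-3) + A i * T p-3 (+ p-2))
      ≡⟨ cong -_ (sym (ℤ.*-distribˡ-+ (A i) _ _)) ⟩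
    - (A i * (T p-3 (+ p-3) + T p-3 (+ p-2)))
      ≈⟨ -‿cong (*-congˡ (A i) T[p-3,p-3]+T[p-3,p-2]) ⟩
    - (A i * + 0)
      ≡⟨ cong -_ (ℤ.*-zeroʳ (A i)) ⟩
    + 0
      ∎
    where
    open ≈-Reasoning
    m₀ x : ℕ
    m₀ = i ℕ.* p ℕ.+ p-3
    x  = withTrailing (2 ℕ.* k) m₀

  motzkin≈0-iii : ∀ {n} → ∃[ i ] ∃[ k ] (n ℕ.+ 1 ≡ (p ℕ.* i ℕ.+ 2) ℕ.* p ℕ.^ (2 ℕ.* k ℕ.+ 1)) →
                  + motzkin n ≈ + 0
  motzkin≈0-iii {n} (i , k , eq) = begin
    + motzkin n
      ≡⟨ cong (+_ ∘ motzkin) (decode 0 m₀ (2 ℕ.* k) 0<p eq (p*i+[1+r]≡i*p+r+1 i 1) (2k+1≡1+2k k)) ⟩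
    + motzkin (x ℕ.* p ℕ.+ p-1)
      ≈⟨ motzkin-last-digit-p-1 x ⟩
    B x - A x
      ≈⟨ -cong (B-trailing-even k m₀) (A-trailing-even k m₀) ⟩
    B m₀ - A m₀
      ≈⟨ -cong (B-first-digit i 1 2<p) (A-first-digit i 1 1<p) ⟩
    A i * + 1 - A i * + 1
      ≡⟨ ℤ.+-inverseʳ (A i * + 1) ⟩
    + 0
      ∎
    where
    open ≈-Reasoning
    m₀ x : ℕ
    m₀ = i ℕ.* p ℕ.+ 1
    x  = withTrailing (2 ℕ.* k) m₀

  motzkin≈0-iv : ∀ {n} → ∃[ i ] ∃[ k ] (k ℕ.≥ 1 × n ℕ.+ 1 ≡ (p ℕ.* i ℕ.+ p ℕ.∸ 1) ℕ.* p ℕ.^ (2 ℕ.* k)) →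
                 + motzkin n ≈ + 0
  motzkin≈0-iv {n} (i , suc k , _ , eq) = begin
    + motzkin n
      ≡⟨ cong (+_ ∘ motzkin) (decode 0 m₀ (suc (2 ℕ.* k)) 0<p eq (p*i+p∸d≡i*p+r+1 i p-2 1 (ℕ.+-comm p-2 2))
                                    (2[1+k]≡2+2k k)) ⟩
    + motzkin (x ℕ.* p ℕ.+ p-1)
      ≈⟨ motzkin-last-digit-p-1 x ⟩
    B x - A x
      ≈⟨ -cong (B-trailing-odd k m₀) (A-trailing-odd k m₀) ⟩
    (B m₀ + A m₀) - - A m₀
      ≈⟨ -cong (+-cong (B-first-digit i p-2 p-1<p) A[m₀]) (-‿cong A[m₀]) ⟩
    (A i * T p-2 (+ p-1) + A i * T p-2 (+ p-2)) - - (A i * T p-2 (+ p-2))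
      ≡⟨ collect (A i) (T p-2 (+ p-2)) (T p-2 (+ p-1)) ⟩
    A i * (+ 2 * T p-2 (+ p-2) + T p-2 (+ p-1))
      ≈⟨ *-congˡ (A i) 2T[p-2,p-2]+T[p-2,p-1] ⟩
    A i * + 0
      ≡⟨ ℤ.*-zeroʳ (A i) ⟩
    + 0
      ∎
    where
    open ≈-Reasoning
    m₀ x : ℕ
    m₀ = i ℕ.* p ℕ.+ p-2
    x  = withTrailing (suc (2 ℕ.* k)) m₀
    A[m₀] : A m₀ ≈ A i * T p-2 (+ p-2)
    A[m₀] = A-first-digit i p-2 p-2<p
    collect : ∀ a x y → (a * y + a * x) - - (a * x) ≡ a * (+ 2 * x + y)
    collect = solve-∀

open import Data.Nat using (_+_; _*_; _∸_; _^_; _≥_; _%_)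
open import Data.Nat.Divisibility using (_∣_)
open import Data.Sum using (_⊎_)

p%6≡5⇒p≡5+6a : ∀ p → p % 6 ≡ 5 → ∃[ a ] p ≡ 5 + 6 * a
p%6≡5⇒p≡5+6a p p%6≡5 = p ℕ./ 6 , trans (m≡m%n+[m/n]*n p 6) (cong₂ _+_ p%6≡5 (ℕ.*-comm (p ℕ./ 6) 6))

mainTheorem3 : (p : ℕ) → Prime p → p ≥ 5 → p % 6 ≡ 5 → (n : ℕ) →
    ((∃[ i ] ∃[ k ] (k ≥ 1 × n + 2 ≡ (p * i + 1) * p ^ (2 * k)))
     ⊎ (∃[ i ] ∃[ k ] (n + 2 ≡ (p * i + p ∸ 2) * p ^ (2 * k + 1)))
     ⊎ (∃[ i ] ∃[ k ] (n + 1 ≡ (p * i + 2) * p ^ (2 * k + 1)))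
     ⊎ (∃[ i ] ∃[ k ] (k ≥ 1 × n + 1 ≡ (p * i + p ∸ 1) * p ^ (2 * k))))
    → p ∣ motzkin n
mainTheorem3 p p-prime _ p%6≡5 n hyp with p%6≡5⇒p≡5+6a p p%6≡5
... | a , refl = ≈0⇒∣ ([ motzkin≈0-i , [ motzkin≈0-ii , [ motzkin≈0-iii , motzkin≈0-iv ]′ ]′ ]′ hyp)
  where
  open Prime≡5mod6 a p-prime
  open Congruence (5 + 6 * a)
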